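{- Let $S=(N,M_0)$ be any Petri net system and let $S^\Theta=(N^\Theta,M_0^\Theta)$ be obtained from $S$ by transformation $\Theta$. Then: (1) If $S$ has at most one shared place, so does $S^\Theta$; if $S$ is homogeneous, so is $S^\Theta$; if $S$ is an H1S-WMG$_\le$, so is $S^\Theta$; if $S$ is a strongly connected H1S-WMG$_\le$ whose shared place deletion (if any) yields a strongly connected WMG$_\le$, then $S^\Theta$ also has these properties. (2) For every sequence $\alpha$ feasible in $S$, the expanded sequence $\theta(\alpha)$ is feasible in $S^\Theta$. (3) For every sequence $\beta'$ feasible in $S^\Theta$, the reduced sequence $\beta=\hat\theta(\beta')$ is also feasible in $S^\Theta$, and there is a sequence $\alpha$ feasible in $S$ such that $\theta(\alpha)$ is feasible in $S^\Theta$ and $\mathbf{P}(\theta(\alpha))=\mathbf{P}(\beta)$. (4) If every place of $S$ has a structural bound, then every place of $S^\Theta$ has a structural bound. (5) $S^\Theta$ is deadlockable if and only if $S$ is deadlockable. (6) $S^\Theta$ is live if and only if $S$ is live.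
   Context: A Petri net is $N=(P,T,W)$ with finite disjoint sets $P$, $T$ and $W:(P\times T)\cup(T\times P)\to\mathbb{N}$; ${}^\bullet n=\{n':W(n',n)>0\}$, $n^\bullet=\{n':W(n,n')>0\}$. Incidence matrix $I(p,t)=W(t,p)-W(p,t)$; transition $t$ is enabled at $M\in\mathbb{N}^P$ if $M(p)\ge W(p,t)$ for all $p$; firing gives $M+I[\cdot,t]$. A system is deadlockable if some reachable marking enables no transition; it is live if for every transition $t$ and reachable marking, some further reachable marking enables $t$. $\mathbf{P}(\sigma)$ is the Parikh vector. The structural bound of place $p$ in $S$ is $\max\{M(p): M\in\mathbb{N}^P, \exists Y\in\mathbb{N}^T, M=M_0+I\cdot Y\}$ when this maximum exists. A place $p$ is shared if $|p^\bullet|\ge2$; $N$ is homogeneous if for each place all output weights are equal; H1S = homogeneous with at most one shared place; WMG$_\le$ = each place has at most one input and at most one output; deleting a place removes it and its arcs, keeping all transitions; H1S-WMG$_\le$ = H1S net whose shared-place deletion (if any) gives a WMG$_\le$. Strong connectedness refers to the graph with arcs $x\to y$ whenever $W(x,y)>0$. Transformation $\Theta$: start with $S^\Theta:=S$; for each pair $(p,t)$ with $p$ a place, $p^\bullet=\{t\}$ and $t$ having at least two input places: add new places $p_a^{(p,t)}$ (initially $0$ tokens) and $p_b^{(p,t)}$ (initially $1$ token) and a new transition $t_p^{(p,t)}$; set $W^\Theta(p,t_p^{(p,t)}):=W(p,t)$ and $W^\Theta(t_p^{(p,t)},p_a^{(p,t)})=W^\Theta(p_a^{(p,t)},t)=W^\Theta(t,p_b^{(p,t)})=W^\Theta(p_b^{(p,t)},t_p^{(p,t)})=1$;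 remove the arc $(p,t)$. Call the added transitions new transitions. For a transition $t$ of $S$, let $NewTransPre(t)$ be the set of new transitions lying in ${}^\bullet({}^\bullet t)$ (in $N^\Theta$), and for a set $A$ of transitions let $Seq(A)$ be the sequence containing each element of $A$ once in a fixed order ($\epsilon$ if $A=\emptyset$). Expanded sequence: $\theta(\epsilon)=\epsilon$ and $\theta(t\alpha')=Seq(NewTransPre(t))\,t\,\theta(\alpha')$. Reduced sequence: for a sequence $\beta$ of $S^\Theta$, $\hat\theta(\beta)$ is obtained by removing each occurrence of a new transition $t_{p_i}$ such that, writing $\{t\}=(t_{p_i}^\bullet)^\bullet$, no occurrence of $t$ appears after this occurrence. -}

module Defs where

open import Data.Nat using (ℕ; zero; suc; _+_; _∸_; _≤_; _<_)
open import Data.Nat.Properties using (_<?_)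
open import Data.Integer as ℤ using (ℤ; +_)
open import Data.Fin using (Fin; _↑ˡ_; _↑ʳ_; splitAt)
open import Data.Fin.Properties as FinP using (_≟_)
open import Data.List using (List; []; _∷_; _++_; length; filter; allFin; lookup; map; cartesianProduct)
open import Data.List.Relation.Unary.Any as ListAny using (Any)
open import Data.Product using (Σ; ∃; ∃₂; _×_; _,_; proj₁; proj₂)
open import Data.Sum using (_⊎_; inj₁; inj₂)
import Data.Sum as Sum
open import Data.Unit using (⊤)
open import Relation.Nullary using (¬_; Dec; yes; no)
open import Relation.Nullary.Decidable using (_×-dec_; _→-dec_; ¬?)
open import Relation.Binary.PropositionalEquality using (_≡_; _≢_)
open import Relation.Binary.Construct.Closure.ReflexiveTransitive using (Star)

-- Petri nets  N = (P, T, W) with P = Fin np, T = Fin nt.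
-- pre p t = W(p,t),  post t p = W(t,p).

record Net : Set where
  field
    np   : ℕ
    nt   : ℕ
    pre  : Fin np → Fin nt → ℕ
    post : Fin nt → Fin np → ℕ

open Net public

Marking : Net → Set
Marking N = Fin (np N) → ℕ

record System : Set where
  constructor ⟨_,_⟩
  field
    net : Net
    M₀  : Marking net

open System public

Trans : Net → Set
Trans N = Fin (nt N)

Enabled : (N : Net) → Marking N → Trans N → Set
Enabled N M t = ∀ p → pre N p t ≤ M p

fire : (N : Net) → Marking N → Trans N → Marking N
fire N M t p = M p ∸ pre N p t + post N t p

data Fires (N : Net) : Marking N → List (Trans N) → Marking N → Set where
  done : ∀ {M} → Fires N M [] M
  step : ∀ {M t σ M'} → Enabled N M t → Fires N (fire N M t) σ M' → Fires N M (t ∷ σ) M'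

Feasible : (S : System) → List (Trans (net S)) → Set
Feasible S σ = ∃ λ M → Fires (net S) (M₀ S) σ M

Reachable : (S : System) → Marking (net S) → Set
Reachable S M = ∃ λ σ → Fires (net S) (M₀ S) σ M

Deadlockable : System → Set
Deadlockable S = ∃ λ M → Reachable S M × (∀ t → ¬ Enabled (net S) M t)

Live : System → Set
Live S = ∀ (t : Trans (net S)) (M : Marking (net S)) → Reachable S M →
         ∃₂ λ σ M' → Fires (net S) M σ M' × Enabled (net S) M' t

parikh : ∀ {n} → List (Fin n) → Fin n → ℕ
parikh σ t = length (filter (_≟ t) σ)

incidence : (N : Net) → Fin (np N) → Trans N → ℤ
incidence N p t = + post N t p ℤ.- + pre N p t

sumFin : (n : ℕ) → (Fin n → ℤ) → ℤ
sumFin zero    f = + 0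
sumFin (suc n) f = f Fin.zero ℤ.+ sumFin n (λ i → f (Fin.suc i))

StateEq : (S : System) → Marking (net S) → (Trans (net S) → ℕ) → Set
StateEq S M Y = ∀ q → + M q ≡ + M₀ S q ℤ.+ sumFin (nt (net S)) (λ t → incidence (net S) q t ℤ.* + Y t)

HasStructBound : (S : System) → Fin (np (net S)) → Set
HasStructBound S p =
  Σ ℕ λ B → (∃₂ λ M Y → StateEq S M Y × M p ≡ B)
          × (∀ M Y → StateEq S M Y → M p ≤ B)

outDeg : (N : Net) → Fin (np N) → ℕ
outDeg N p = length (filter (λ t → 0 <? pre N p t) (allFin (nt N)))

inDeg : (N : Net) → Fin (np N) → ℕ
inDeg N p = length (filter (λ t → 0 <? post N t p) (allFin (nt N)))

inDegT : (N : Net) → Trans N → ℕ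
inDegT N t = length (filter (λ p → 0 <? pre N p t) (allFin (np N)))

Shared : (N : Net) → Fin (np N) → Set
Shared N p = 2 ≤ outDeg N p

AtMostOneShared : Net → Set
AtMostOneShared N = ∀ p q → Shared N p → Shared N q → p ≡ q

Homogeneous : Net → Set
Homogeneous N = ∀ p t t' → 0 < pre N p t → 0 < pre N p t' → pre N p t ≡ pre N p t'

H1S : Net → Set
H1S N = Homogeneous N × AtMostOneShared N

-- Sub-nets obtained by deleting places are described by the predicate
-- `keep` on the places that remain (all transitions are kept).

WMG≤On : (N : Net) → (Fin (np N) → Set) → Set
WMG≤On N keep = ∀ p → keep p → inDeg N p ≤ 1 × outDeg N p ≤ 1

WMG≤ : Net → Set
WMG≤ N = WMG≤On N (λ _ → ⊤)

Node : Net → Set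
Node N = Fin (np N) ⊎ Trans N

KeepNode : (N : Net) → (Fin (np N) → Set) → Node N → Set
KeepNode N keep (inj₁ p) = keep p
KeepNode N keep (inj₂ t) = ⊤

Arc : (N : Net) → Node N → Node N → Set
Arc N (inj₁ p) (inj₂ t) = 0 < pre N p t
Arc N (inj₂ t) (inj₁ p) = 0 < post N t p
Arc N (inj₁ p) (inj₁ q) = Data.Empty.⊥
  where import Data.Empty
Arc N (inj₂ t) (inj₂ u) = Data.Empty.⊥
  where import Data.Empty

ArcOn : (N : Net) → (Fin (np N) → Set) → Node N → Node N → Set
ArcOn N keep x y = KeepNode N keep x × KeepNode N keep y × Arc N x y

StronglyConnectedOn : (N : Net) → (Fin (np N) → Set) → Set
StronglyConnectedOn N keep =
  ∀ x y → KeepNode N keep x → KeepNode N keep y → Star (ArcOn N keep) x y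

StronglyConnected : Net → Set
StronglyConnected N = StronglyConnectedOn N (λ _ → ⊤)

-- "the shared-place deletion (if any) satisfies Q"
SharedDeletion : (N : Net) → ((Fin (np N) → Set) → Set) → Set
SharedDeletion N Q =
  (∀ p → Shared N p → Q (λ q → q ≢ p)) × ((∀ p → ¬ Shared N p) → Q (λ _ → ⊤))

H1S-WMG≤ : Net → Set
H1S-WMG≤ N = H1S N × SharedDeletion N (WMG≤On N)

SC-H1S-WMG≤ : Net → Set
SC-H1S-WMG≤ N = StronglyConnected N × H1S N
              × SharedDeletion N (λ keep → WMG≤On N keep × StronglyConnectedOn N keep)

ifDec : ∀ {a} {A : Set a} → Dec A → ℕ → ℕ → ℕ
ifDec (yes _) m n = m
ifDec (no _)  m n = n

module Θ (S : System) where
  N = net S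
  P = Fin (np N)
  T = Fin (nt N)

  ThetaPair : P × T → Set
  ThetaPair (p , t) = (0 < pre N p t × (∀ t' → 0 < pre N p t' → t' ≡ t)) × 2 ≤ inDegT N t

  thetaPair? : ∀ x → Dec (ThetaPair x)
  thetaPair? (p , t) =
    ((0 <? pre N p t) ×-dec FinP.all? (λ t' → (0 <? pre N p t') →-dec (t' ≟ t)))
    ×-dec (2 ≤? inDegT N t)
    where open import Data.Nat.Properties using (_≤?_)

  Sel : List (P × T)
  Sel = filter thetaPair? (cartesianProduct (allFin (np N)) (allFin (nt N)))

  k : ℕ
  k = length Sel

  sP : Fin k → P
  sP i = proj₁ (lookup Sel i)

  sT : Fin k → T
  sT i = proj₂ (lookup Sel i)

  -- places of N^Θ: old places, then p_a^(i), then p_b^(i)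
  -- transitions of N^Θ: old transitions, then new transitions t_p^(i)
  PV = P ⊎ (Fin k ⊎ Fin k)
  TV = T ⊎ Fin k

  preV : PV → TV → ℕ
  preV (inj₁ p) (inj₁ t) =
    ifDec (FinP.any? (λ i → (sP i ≟ p) ×-dec (sT i ≟ t))) 0 (pre N p t)
  preV (inj₁ p) (inj₂ i)        = ifDec (sP i ≟ p) (pre N p (sT i)) 0
  preV (inj₂ (inj₁ i)) (inj₁ t) = ifDec (sT i ≟ t) 1 0
  preV (inj₂ (inj₁ i)) (inj₂ j) = 0
  preV (inj₂ (inj₂ i)) (inj₁ t) = 0
  preV (inj₂ (inj₂ i)) (inj₂ j) = ifDec (i ≟ j) 1 0

  postV : TV → PV → ℕ
  postV (inj₁ t) (inj₁ p)        = post N t p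
  postV (inj₁ t) (inj₂ (inj₁ i)) = 0
  postV (inj₁ t) (inj₂ (inj₂ i)) = ifDec (sT i ≟ t) 1 0
  postV (inj₂ i) (inj₁ p)        = 0
  postV (inj₂ i) (inj₂ (inj₁ j)) = ifDec (i ≟ j) 1 0
  postV (inj₂ i) (inj₂ (inj₂ j)) = 0

  pview : Fin (np N + (k + k)) → PV
  pview x = Sum.map₂ (splitAt k) (splitAt (np N) x)

  tview : Fin (nt N + k) → TV
  tview x = splitAt (nt N) x

  NΘ : Net
  NΘ = record
    { np   = np N + (k + k)
    ; nt   = nt N + k
    ; pre  = λ p t → preV (pview p) (tview t)
    ; post = λ t p → postV (tview t) (pview p)
    }

  M0V : PV → ℕ
  M0V (inj₁ p)        = M₀ S p
  M0V (inj₂ (inj₁ i)) = 0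
  M0V (inj₂ (inj₂ i)) = 1

  SΘ : System
  SΘ = ⟨ NΘ , (λ p → M0V (pview p)) ⟩

  oldT : T → Trans NΘ
  oldT t = t ↑ˡ k

  newT : Fin k → Trans NΘ
  newT i = nt N ↑ʳ i

  InNewTransPre : T → Fin k → Set
  InNewTransPre t i = ∃ λ q → 0 < pre NΘ q (oldT t) × 0 < post NΘ (newT i) q

  inNewTransPre? : ∀ t i → Dec (InNewTransPre t i)
  inNewTransPre? t i = FinP.any? (λ q → (0 <? pre NΘ q (oldT t)) ×-dec (0 <? post NΘ (newT i) q))

  -- Seq(NewTransPre(t)), fixed order = increasing index
  seqNewTransPre : T → List (Trans NΘ)
  seqNewTransPre t = map newT (filter (inNewTransPre? t) (allFin k))

  θ : List T → List (Trans NΘ)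
  θ []      = []
  θ (t ∷ α) = seqNewTransPre t ++ (oldT t ∷ θ α)

  IsNew : Trans NΘ → Set
  IsNew x = ∃ λ i → x ≡ newT i

  isNew? : ∀ x → Dec (IsNew x)
  isNew? x = FinP.any? (λ i → x FinP.≟ newT i)

  PostPost : Trans NΘ → Trans NΘ → Set
  PostPost x y = ∃ λ q → 0 < post NΘ x q × 0 < pre NΘ q y

  postPost? : ∀ x y → Dec (PostPost x y)
  postPost? x y = FinP.any? (λ q → (0 <? post NΘ x q) ×-dec (0 <? pre NΘ q y))

  θ̂ : List (Trans NΘ) → List (Trans NΘ)
  θ̂ [] = []
  θ̂ (x ∷ β) with isNew? x ×-dec ¬? (ListAny.any? (postPost? x) β)
  ... | yes _ = θ̂ β
  ... | no  _ = x ∷ θ̂ β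

-- Transformation Θ splits each arc (p,t), where p has t as sole output and t has
-- several inputs, by a new transition t_p that moves W(p,t) tokens from p to p_a
-- ahead of time, while the complementary places p_a, p_b (p_a + p_b = 1) allow at
-- most one such early move per firing of t.  A marking M of S^Θ therefore stands
-- for the marking m of S with m(p) = M(p) + W(p,t)·M(p_a) for split arcs and
-- m(p) = M(p) otherwise.  Under this correspondence firing t_p leaves m unchanged,
-- firing an old transition t in S^Θ is firing t in S, and firing t in S is
-- simulated by first firing the pending t_p's; feasibility, deadlocks and liveness
-- transfer in both directions.  The reduced sequence θ̂ only omits early moves
-- that are never consumed, which can only increase the marking.  For structural
-- bounds, solutions of the state equation transfer both ways along the same
-- correspondence, and the new places are bounded by p_a + p_b = 1.
module Submission where

open import Defs
open import Data.Product using (_×_; ∃; ∃₂; _,_; proj₁; proj₂)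
open import Data.Sum using (_⊎_; inj₁; inj₂)
import Data.Sum as Sum
open import Data.Unit using (⊤; tt)
open import Data.Empty using (⊥-elim)
open import Function using (_∘_)
open import Function.Bundles using (_⇔_; mk⇔)
open import Relation.Nullary using (¬_; Dec; yes; no)
open import Relation.Nullary.Decidable using (_×-dec_; ¬?)
open import Relation.Binary.PropositionalEquality
  using (_≡_; _≢_; refl; sym; trans; cong; cong₂; subst; subst₂; module ≡-Reasoning)
open import Relation.Binary.Construct.Closure.ReflexiveTransitive using (Star; ε; _◅_; _◅◅_)

open import Data.Nat as ℕ using (ℕ; zero; suc; _+_; _∸_; _≤_; _<_; z≤n; s≤s; _*_; >-nonZero)
open import Data.Nat.Properties
open import Data.Nat.Tactic.RingSolver using (solve-∀)
open import Data.Integer as ℤ using (ℤ; +_)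
import Data.Integer.Properties as ℤP
open import Data.Integer.Tactic.RingSolver renaming (solve-∀ to ℤ-solve-∀)
open import Data.Fin as F using (Fin; _↑ˡ_; _↑ʳ_; splitAt; join)
import Data.Fin.Properties as FP
open import Data.List using (List; []; _∷_; _++_; length; filter; allFin; lookup; map; cartesianProduct)
open import Data.List.Relation.Unary.All as All using (All; []; _∷_)
open import Data.List.Relation.Unary.Any as Any using (here; there)
open import Data.List.Relation.Unary.AllPairs using (_∷_)
open import Data.List.Relation.Unary.Unique.Propositional using (Unique)
import Data.List.Relation.Unary.Unique.Propositional.Properties as UP
open import Data.List.Membership.Propositional using (_∈_; _∉_)
import Data.List.Membership.Propositional.Properties as MP

ifDec-yes : ∀ {a} {A : Set a} (d : Dec A) {m n : ℕ} → A → ifDec d m n ≡ m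
ifDec-yes (yes _) _ = refl
ifDec-yes (no ¬a) a = ⊥-elim (¬a a)

ifDec-no : ∀ {a} {A : Set a} (d : Dec A) {m n : ℕ} → ¬ A → ifDec d m n ≡ n
ifDec-no (yes a) ¬a = ⊥-elim (¬a a)
ifDec-no (no _) _ = refl

ifDec-elim : ∀ {a b} {A : Set a} (P : ℕ → Set b) (d : Dec A) {m n : ℕ} →
             (A → P m) → (¬ A → P n) → P (ifDec d m n)
ifDec-elim P (yes a) f g = f a
ifDec-elim P (no ¬a) f g = g ¬a

ifDec-⇔ : ∀ {a b} {A : Set a} {B : Set b} → (A → B) → (B → A) →
          (d : Dec A) (e : Dec B) {m n : ℕ} → ifDec d m n ≡ ifDec e m n
ifDec-⇔ f g (yes _) (yes _) = refl
ifDec-⇔ f g (no _) (no _) = refl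
ifDec-⇔ f g (yes a) (no ¬b) = ⊥-elim (¬b (f a))
ifDec-⇔ f g (no ¬a) (yes b) = ⊥-elim (¬a (g b))

ifDec-pos : ∀ {a} {A : Set a} (d : Dec A) {m : ℕ} → 0 < ifDec d m 0 → A
ifDec-pos (yes a) _ = a
ifDec-pos (no _) ()

ifDec-yes-pos : ∀ {a} {A : Set a} (d : Dec A) {m : ℕ} → A → 0 < m → 0 < ifDec d m 0
ifDec-yes-pos d a h = subst (0 <_) (sym (ifDec-yes d a)) h

m+n≡1⇒ : ∀ m n → m + n ≡ 1 → (m ≡ 0 × n ≡ 1) ⊎ (m ≡ 1 × n ≡ 0)
m+n≡1⇒ zero n e = inj₁ (refl , e)
m+n≡1⇒ (suc zero) zero e = inj₂ (refl , refl)
m+n≡1⇒ (suc zero) (suc n) ()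
m+n≡1⇒ (suc (suc m)) n ()

lookup-injective : ∀ {A : Set} {xs : List A} → Unique xs → ∀ i j → lookup xs i ≡ lookup xs j → i ≡ j
lookup-injective (_ ∷ _) F.zero F.zero e = refl
lookup-injective (a ∷ _) F.zero (F.suc j) e = ⊥-elim (All.lookup a (MP.∈-lookup j) e)
lookup-injective (a ∷ _) (F.suc i) F.zero e = ⊥-elim (All.lookup a (MP.∈-lookup i) (sym e))
lookup-injective (_ ∷ u) (F.suc i) (F.suc j) e = cong F.suc (lookup-injective u i j e)

length≥2⇒distinct : ∀ {A : Set} (xs : List A) → Unique xs → 2 ≤ length xs →
                    ∃₂ λ a b → a ≢ b × a ∈ xs × b ∈ xs
length≥2⇒distinct (_ ∷ []) _ (s≤s ())
length≥2⇒distinct (a ∷ b ∷ _) ((a≢b ∷ _) ∷ _) _ = a , b , a≢b , here refl , there (here refl)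

distinct⇒length≥2 : ∀ {A : Set} (xs : List A) a b → a ∈ xs → b ∈ xs → a ≢ b → 2 ≤ length xs
distinct⇒length≥2 (c ∷ []) a b (here refl) (here refl) a≢b = ⊥-elim (a≢b refl)
distinct⇒length≥2 (c ∷ d ∷ _) a b _ _ _ = s≤s (s≤s z≤n)

length≤1⇒≡ : ∀ {A : Set} (xs : List A) a b → a ∈ xs → b ∈ xs → length xs ≤ 1 → a ≡ b
length≤1⇒≡ (c ∷ []) a b (here refl) (here refl) _ = refl
length≤1⇒≡ (c ∷ d ∷ _) a b _ _ (s≤s ())

module Count {n : ℕ} {P : Fin n → Set} (P? : (i : Fin n) → Dec (P i)) where
  private
    ys : List (Fin n)
    ys = filter P? (allFin n)

    ∈ys : ∀ i → P i → i ∈ ys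
    ∈ys i p = MP.∈-filter⁺ P? (MP.∈-allFin i) p

    ∈ys⇒ : ∀ {i} → i ∈ ys → P i
    ∈ys⇒ m = proj₂ (MP.∈-filter⁻ P? {xs = allFin n} m)

  two≤⇒distinct : 2 ≤ length ys → ∃₂ λ i j → i ≢ j × P i × P j
  two≤⇒distinct le with length≥2⇒distinct ys (UP.filter⁺ P? (UP.allFin⁺ n)) le
  ... | i , j , i≢j , i∈ , j∈ = i , j , i≢j , ∈ys⇒ i∈ , ∈ys⇒ j∈

  distinct⇒two≤ : ∀ i j → i ≢ j → P i → P j → 2 ≤ length ys
  distinct⇒two≤ i j i≢j pi pj = distinct⇒length≥2 ys i j (∈ys i pi) (∈ys j pj) i≢j

  ≤1⇒unique : length ys ≤ 1 → ∀ i j → P i → P j → i ≡ j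
  ≤1⇒unique le i j pi pj = length≤1⇒≡ ys i j (∈ys i pi) (∈ys j pj) le

  unique⇒≤1 : (∀ i j → P i → P j → i ≡ j) → length ys ≤ 1
  unique⇒≤1 h with 2 ≤? length ys
  ... | yes le = let (i , j , i≢j , pi , pj) = two≤⇒distinct le in ⊥-elim (i≢j (h i j pi pj))
  ... | no nle = ≤-pred (≰⇒> nle)

parikh-∷-≡ : ∀ {n} (x : Fin n) σ → parikh (x ∷ σ) x ≡ suc (parikh σ x)
parikh-∷-≡ x σ with x FP.≟ x
... | yes _ = refl
... | no x≢x = ⊥-elim (x≢x refl)

parikh-∷-≢ : ∀ {n} (x y : Fin n) σ → y ≢ x → parikh (y ∷ σ) x ≡ parikh σ x
parikh-∷-≢ x y σ y≢x with y FP.≟ x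
... | yes y≡x = ⊥-elim (y≢x y≡x)
... | no _ = refl

parikh-∷ : ∀ {n} (y x : Fin n) σ → parikh (y ∷ σ) x ≡ ifDec (y FP.≟ x) 1 0 + parikh σ x
parikh-∷ y x σ with y FP.≟ x
... | yes _ = refl
... | no _ = refl

parikh-++ : ∀ {n} (σ τ : List (Fin n)) x → parikh (σ ++ τ) x ≡ parikh σ x + parikh τ x
parikh-++ [] τ x = refl
parikh-++ (y ∷ σ) τ x with y FP.≟ x
... | yes _ = cong suc (parikh-++ σ τ x)
... | no _ = parikh-++ σ τ x

parikh-∉ : ∀ {n} (σ : List (Fin n)) x → x ∉ σ → parikh σ x ≡ 0
parikh-∉ [] x _ = refl
parikh-∉ (y ∷ σ) x x∉ = trans (parikh-∷-≢ x y σ (λ e → x∉ (here (sym e)))) (parikh-∉ σ x (λ m → x∉ (there m)))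

parikh-∈ : ∀ {n} (σ : List (Fin n)) x → x ∈ σ → 1 ≤ parikh σ x
parikh-∈ (y ∷ σ) x (here refl) = subst (1 ≤_) (sym (parikh-∷-≡ x σ)) (s≤s z≤n)
parikh-∈ (y ∷ σ) x (there m) with y FP.≟ x
... | yes _ = s≤s z≤n
... | no _ = parikh-∈ σ x m

parikh-map : ∀ {m n} (f : Fin m → Fin n) → (∀ i j → f i ≡ f j → i ≡ j) →
             ∀ L i → parikh (map f L) (f i) ≡ parikh L i
parikh-map f f-inj [] i = refl
parikh-map f f-inj (j ∷ L) i with j FP.≟ i | f j FP.≟ f i
... | yes _ | yes _ = cong suc (parikh-map f f-inj L i)
... | no _ | no _ = parikh-map f f-inj L i
... | yes refl | no fj≢fi = ⊥-elim (fj≢fi refl)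
... | no j≢i | yes e = ⊥-elim (j≢i (f-inj j i e))

parikh-unique : ∀ {n} (σ : List (Fin n)) x → Unique σ → x ∈ σ → parikh σ x ≡ 1
parikh-unique (y ∷ σ) x (y∉ ∷ u) (here refl) =
  trans (parikh-∷-≡ x σ) (cong suc (parikh-∉ σ x (λ m → All.lookup y∉ m refl)))
parikh-unique (y ∷ σ) x (y∉ ∷ u) (there m) =
  trans (parikh-∷-≢ x y σ (All.lookup y∉ m)) (parikh-unique σ x u m)

module _ {N : Net} where
  Covers : Marking N → Marking N → List (Trans N) → Set
  Covers M' M σ = ∀ p → M p ≤ M' p ⊎ All (λ y → pre N p y ≡ 0) σ

  fires-covered : ∀ {M M' σ E} → Fires N M σ E → Covers M' M σ → ∃ λ E' → Fires N M' σ E'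
  fires-covered done cov = _ , done
  fires-covered {M} {M'} {t ∷ σ} (step en fs) cov = _ , step en' (proj₂ (fires-covered fs cov'))
    where
    cov' : Covers (fire N M' t) (fire N M t) σ
    cov' p with cov p
    ... | inj₁ le = inj₁ (+-monoˡ-≤ (post N t p) (∸-monoˡ-≤ (pre N p t) le))
    ... | inj₂ (_ ∷ a) = inj₂ a
    en' : Enabled N M' t
    en' p with cov p
    ... | inj₁ le = ≤-trans (en p) le
    ... | inj₂ (z ∷ _) = subst (_≤ M' p) (sym z) z≤n

  fires-++ : ∀ {M σ τ M₁ E} → Fires N M σ M₁ → Fires N M₁ τ E → Fires N M (σ ++ τ) E
  fires-++ done f = f
  fires-++ (step e f) g = step e (fires-++ f g)

sumFin-cong : ∀ n {f g : Fin n → ℤ} → (∀ i → f i ≡ g i) → sumFin n f ≡ sumFin n g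
sumFin-cong zero h = refl
sumFin-cong (suc n) h = cong₂ ℤ._+_ (h F.zero) (sumFin-cong n (λ i → h (F.suc i)))

sumFin-++ : ∀ n m (f : Fin (n + m) → ℤ) →
            sumFin (n + m) f ≡ sumFin n (λ i → f (i ↑ˡ m)) ℤ.+ sumFin m (λ j → f (n ↑ʳ j))
sumFin-++ zero m f = sym (ℤP.+-identityˡ _)
sumFin-++ (suc n) m f = trans (cong (λ z → f F.zero ℤ.+ z) (sumFin-++ n m (λ i → f (F.suc i))))
                              (sym (ℤP.+-assoc (f F.zero) _ _))

sumFin-zero : ∀ n (f : Fin n → ℤ) → (∀ i → f i ≡ + 0) → sumFin n f ≡ + 0
sumFin-zero zero f h = refl
sumFin-zero (suc n) f h = cong₂ ℤ._+_ (h F.zero) (sumFin-zero n (λ i → f (F.suc i)) (λ i → h (F.suc i)))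

sumFin-single : ∀ n (f : Fin n → ℤ) j → (∀ i → i ≢ j → f i ≡ + 0) → sumFin n f ≡ f j
sumFin-single (suc n) f F.zero h =
  trans (cong (λ z → f F.zero ℤ.+ z) (sumFin-zero n (λ i → f (F.suc i)) (λ i → h (F.suc i) (λ ()))))
        (ℤP.+-identityʳ _)
sumFin-single (suc n) f (F.suc j) h =
  trans (cong₂ ℤ._+_ (h F.zero (λ ()))
                     (sumFin-single n (λ i → f (F.suc i)) j (λ i i≢j → h (F.suc i) (i≢j ∘ FP.suc-injective))))
        (ℤP.+-identityˡ _)

sumFin-+ : ∀ n (f g : Fin n → ℤ) → sumFin n (λ i → f i ℤ.+ g i) ≡ sumFin n f ℤ.+ sumFin n g
sumFin-+ zero f g = refl
sumFin-+ (suc n) f g =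
  trans (cong (λ z → f F.zero ℤ.+ g F.zero ℤ.+ z) (sumFin-+ n (λ i → f (F.suc i)) (λ i → g (F.suc i))))
        (interchange (f F.zero) (g F.zero) _ _)
  where
  interchange : ∀ a b c d → (a ℤ.+ b) ℤ.+ (c ℤ.+ d) ≡ (a ℤ.+ c) ℤ.+ (b ℤ.+ d)
  interchange = ℤ-solve-∀

+-∸ : ∀ m n → n ≤ m → + (m ∸ n) ≡ + m ℤ.- + n
+-∸ m n n≤m = trans (sym (ℤP.⊖-≥ n≤m)) (sym (ℤP.m-n≡m⊖n m n))

stateEq-fire : ∀ (S : System) M Y x → StateEq S M Y → Enabled (net S) M x →
               StateEq S (fire (net S) M x) (λ t → Y t + ifDec (t FP.≟ x) 1 0)
stateEq-fire S M Y x se en q = begin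
  + (M q ∸ pre N q x + post N x q)           ≡⟨ cong (ℤ._+ + post N x q) (+-∸ (M q) (pre N q x) (en q)) ⟩
  + M q ℤ.- + pre N q x ℤ.+ + post N x q     ≡⟨ cong (λ z → z ℤ.- + pre N q x ℤ.+ + post N x q) (se q) ⟩
  + M₀ S q ℤ.+ IY ℤ.- + pre N q x ℤ.+ + post N x q
                                              ≡⟨ regroup (+ M₀ S q) IY (+ pre N q x) (+ post N x q) ⟩
  + M₀ S q ℤ.+ (IY ℤ.+ incidence N q x)      ≡⟨ cong (λ z → + M₀ S q ℤ.+ z) (sym column) ⟩
  + M₀ S q ℤ.+ sumFin (nt N) (λ t → incidence N q t ℤ.* + (Y t + ifDec (t FP.≟ x) 1 0)) ∎
  where
  open ≡-Reasoning
  N = net S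
  IY = sumFin (nt N) (λ t → incidence N q t ℤ.* + Y t)
  regroup : ∀ m s a b → m ℤ.+ s ℤ.- a ℤ.+ b ≡ m ℤ.+ (s ℤ.+ (b ℤ.- a))
  regroup = ℤ-solve-∀
  column : sumFin (nt N) (λ t → incidence N q t ℤ.* + (Y t + ifDec (t FP.≟ x) 1 0)) ≡ IY ℤ.+ incidence N q x
  column = begin
    sumFin (nt N) (λ t → incidence N q t ℤ.* + (Y t + ifDec (t FP.≟ x) 1 0))
      ≡⟨ sumFin-cong (nt N) (λ t → ℤP.*-distribˡ-+ (incidence N q t) (+ Y t) (+ ifDec (t FP.≟ x) 1 0)) ⟩
    sumFin (nt N) (λ t → incidence N q t ℤ.* + Y t ℤ.+ incidence N q t ℤ.* + ifDec (t FP.≟ x) 1 0)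
      ≡⟨ sumFin-+ (nt N) _ _ ⟩
    IY ℤ.+ sumFin (nt N) (λ t → incidence N q t ℤ.* + ifDec (t FP.≟ x) 1 0)
      ≡⟨ cong (λ z → IY ℤ.+ z) (sumFin-single (nt N) _ x (λ t t≢x →
           trans (cong (λ z → incidence N q t ℤ.* + z) (ifDec-no (t FP.≟ x) t≢x)) (ℤP.*-zeroʳ (incidence N q t)))) ⟩
    IY ℤ.+ incidence N q x ℤ.* + ifDec (x FP.≟ x) 1 0
      ≡⟨ cong (λ z → IY ℤ.+ incidence N q x ℤ.* + z) (ifDec-yes (x FP.≟ x) refl) ⟩
    IY ℤ.+ incidence N q x ℤ.* + 1
      ≡⟨ cong (λ z → IY ℤ.+ z) (ℤP.*-identityʳ _) ⟩
    IY ℤ.+ incidence N q x ∎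

module Θ-Basics (S : System) where
  open Θ S public

  pair-selected : ∀ i → ThetaPair (lookup Sel i)
  pair-selected i = proj₂ (MP.∈-filter⁻ thetaPair? {xs = cartesianProduct (allFin (np N)) (allFin (nt N))}
                                        (MP.∈-lookup {xs = Sel} i))

  W : Fin k → ℕ
  W i = pre N (sP i) (sT i)

  W-pos : ∀ i → 0 < W i
  W-pos i = proj₁ (proj₁ (pair-selected i))

  sP-out≡sT : ∀ i t → 0 < pre N (sP i) t → t ≡ sT i
  sP-out≡sT i = proj₂ (proj₁ (pair-selected i))

  pre-sP≡0 : ∀ i t → t ≢ sT i → pre N (sP i) t ≡ 0
  pre-sP≡0 i t t≢ with pre N (sP i) t in eq
  ... | zero = refl
  ... | suc _ = ⊥-elim (t≢ (sP-out≡sT i t (subst (0 <_) (sym eq) (s≤s z≤n))))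

  sP-injective : ∀ i j → sP i ≡ sP j → i ≡ j
  sP-injective i j e = lookup-injective Sel-unique i j (cong₂ _,_ e (sP-out≡sT j (sT i) (subst (λ q → 0 < pre N q (sT i)) e (W-pos i))))
    where
    Sel-unique : Unique Sel
    Sel-unique = UP.filter⁺ thetaPair? (UP.cartesianProduct⁺ (UP.allFin⁺ _) (UP.allFin⁺ _))

  Unpaired : P → Set
  Unpaired p = ∀ i → sP i ≢ p

  paired? : ∀ p → Unpaired p ⊎ ∃ λ i → sP i ≡ p
  paired? p with FP.any? (λ i → sP i FP.≟ p)
  ... | yes x = inj₂ x
  ... | no n = inj₁ (λ i e → n (i , e))

  pinj : PV → Fin (np NΘ)
  pinj (inj₁ p) = p ↑ˡ (k + k)
  pinj (inj₂ (inj₁ i)) = np N ↑ʳ (i ↑ˡ k)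
  pinj (inj₂ (inj₂ i)) = np N ↑ʳ (k ↑ʳ i)

  pview-pinj : ∀ v → pview (pinj v) ≡ v
  pview-pinj (inj₁ p) rewrite FP.splitAt-↑ˡ (np N) p (k + k) = refl
  pview-pinj (inj₂ (inj₁ i)) rewrite FP.splitAt-↑ʳ (np N) (k + k) (i ↑ˡ k) | FP.splitAt-↑ˡ k i k = refl
  pview-pinj (inj₂ (inj₂ i)) rewrite FP.splitAt-↑ʳ (np N) (k + k) (k ↑ʳ i) | FP.splitAt-↑ʳ k k i = refl

  pinj-pview : ∀ x → pinj (pview x) ≡ x
  pinj-pview x with splitAt (np N) x in eq
  ... | inj₁ p = FP.splitAt⁻¹-↑ˡ eq
  ... | inj₂ y with splitAt k y in eq₂
  ... | inj₁ i = trans (cong (np N ↑ʳ_) (FP.splitAt⁻¹-↑ˡ eq₂)) (FP.splitAt⁻¹-↑ʳ eq)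
  ... | inj₂ i = trans (cong (np N ↑ʳ_) (FP.splitAt⁻¹-↑ʳ eq₂)) (FP.splitAt⁻¹-↑ʳ eq)

  pinj-injective : ∀ v v' → pinj v ≡ pinj v' → v ≡ v'
  pinj-injective v v' e = trans (sym (pview-pinj v)) (trans (cong pview e) (pview-pinj v'))

  tinj : TV → Trans NΘ
  tinj (inj₁ t) = oldT t
  tinj (inj₂ i) = newT i

  tview-tinj : ∀ w → tview (tinj w) ≡ w
  tview-tinj (inj₁ t) = FP.splitAt-↑ˡ (nt N) t k
  tview-tinj (inj₂ i) = FP.splitAt-↑ʳ (nt N) k i

  tinj-tview : ∀ x → tinj (tview x) ≡ x
  tinj-tview x = trans (tinj≡join (tview x)) (FP.join-splitAt (nt N) k x)
    where
    tinj≡join : ∀ w → tinj w ≡ join (nt N) k w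
    tinj≡join (inj₁ t) = refl
    tinj≡join (inj₂ i) = refl

  tinj-injective : ∀ w w' → tinj w ≡ tinj w' → w ≡ w'
  tinj-injective w w' e = trans (sym (tview-tinj w)) (trans (cong tview e) (tview-tinj w'))

  oldT-injective : ∀ t u → oldT t ≡ oldT u → t ≡ u
  oldT-injective t u e with tinj-injective (inj₁ t) (inj₁ u) e
  ... | refl = refl

  newT-injective : ∀ i j → newT i ≡ newT j → i ≡ j
  newT-injective i j e with tinj-injective (inj₂ i) (inj₂ j) e
  ... | refl = refl

  oldT≢newT : ∀ t i → oldT t ≢ newT i
  oldT≢newT t i e with tinj-injective (inj₁ t) (inj₂ i) e
  ... | ()

  oldP : P → Fin (np NΘ)
  oldP p = pinj (inj₁ p)

  paP pbP : Fin k → Fin (np NΘ)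
  paP i = pinj (inj₂ (inj₁ i))
  pbP i = pinj (inj₂ (inj₂ i))

  pre-pinj-tinj : ∀ v w → pre NΘ (pinj v) (tinj w) ≡ preV v w
  pre-pinj-tinj v w = cong₂ preV (pview-pinj v) (tview-tinj w)

  post-tinj-pinj : ∀ w v → post NΘ (tinj w) (pinj v) ≡ postV w v
  post-tinj-pinj w v = cong₂ postV (tview-tinj w) (pview-pinj v)

  pre-pos : ∀ v w → 0 < pre NΘ (pinj v) (tinj w) → 0 < preV v w
  pre-pos v w = subst (0 <_) (pre-pinj-tinj v w)

  post-pos : ∀ w v → 0 < post NΘ (tinj w) (pinj v) → 0 < postV w v
  post-pos w v = subst (0 <_) (post-tinj-pinj w v)

  M₀Θ-pinj : ∀ v → M₀ SΘ (pinj v) ≡ M0V v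
  M₀Θ-pinj v = cong M0V (pview-pinj v)

  fire-tinj : ∀ (M : Marking NΘ) w v → fire NΘ M (tinj w) (pinj v) ≡ M (pinj v) ∸ preV v w + postV w v
  fire-tinj M w v = cong₂ (λ a b → M (pinj v) ∸ a + b) (pre-pinj-tinj v w) (post-tinj-pinj w v)

  enabled-tinj⇐ : ∀ (M : Marking NΘ) w → (∀ v → preV v w ≤ M (pinj v)) → Enabled NΘ M (tinj w)
  enabled-tinj⇐ M w h q = subst₂ _≤_ (cong (preV (pview q)) (sym (tview-tinj w))) (cong M (pinj-pview q)) (h (pview q))

  enabled-tinj⇒ : ∀ (M : Marking NΘ) w → Enabled NΘ M (tinj w) → ∀ v → preV v w ≤ M (pinj v)
  enabled-tinj⇒ M w en v = subst (_≤ M (pinj v)) (pre-pinj-tinj v w) (en (pinj v))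

  data TransView : Trans NΘ → Set where
    old : ∀ t → TransView (oldT t)
    new : ∀ i → TransView (newT i)

  transView : ∀ x → TransView x
  transView x = subst TransView (tinj-tview x) (viewOf (tview x))
    where
    viewOf : ∀ w → TransView (tinj w)
    viewOf (inj₁ t) = old t
    viewOf (inj₂ i) = new i

  data PlaceView : Fin (np NΘ) → Set where
    old : ∀ p → PlaceView (oldP p)
    pa  : ∀ i → PlaceView (paP i)
    pb  : ∀ i → PlaceView (pbP i)

  placeView : ∀ q → PlaceView q
  placeView q = subst PlaceView (pinj-pview q) (viewOf (pview q))
    where
    viewOf : ∀ v → PlaceView (pinj v)
    viewOf (inj₁ p) = old p
    viewOf (inj₂ (inj₁ i)) = pa i
    viewOf (inj₂ (inj₂ i)) = pb i

  preV-unpaired : ∀ p t → Unpaired p → preV (inj₁ p) (inj₁ t) ≡ pre N p t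
  preV-unpaired p t unp = ifDec-no (FP.any? (λ i → (sP i FP.≟ p) ×-dec (sT i FP.≟ t))) (λ (i , e , _) → unp i e)

  preV-paired : ∀ i t → preV (inj₁ (sP i)) (inj₁ t) ≡ 0
  preV-paired i t = ifDec-elim (_≡ 0) (FP.any? (λ j → (sP j FP.≟ sP i) ×-dec (sT j FP.≟ t))) (λ _ → refl) absent
    where
    absent : ¬ (∃ λ j → sP j ≡ sP i × sT j ≡ t) → pre N (sP i) t ≡ 0
    absent n with t FP.≟ sT i
    ... | yes e = ⊥-elim (n (i , refl , sym e))
    ... | no t≢ = pre-sP≡0 i t t≢

module Θ-Simulation (S : System) where
  open Θ-Basics S public

  record Corr (m : Marking N) (M : Marking NΘ) : Set where
    field
      pa+pb≡1  : ∀ i → M (paP i) + M (pbP i) ≡ 1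
      unpaired : ∀ p → Unpaired p → M (oldP p) ≡ m p
      paired   : ∀ i → m (sP i) ≡ M (oldP (sP i)) + M (paP i) * W i
  open Corr public

  pa≡0⊎pa≡1 : ∀ {m M} → Corr m M → ∀ i → M (paP i) ≡ 0 ⊎ M (paP i) ≡ 1
  pa≡0⊎pa≡1 {M = M} c i with m+n≡1⇒ (M (paP i)) (M (pbP i)) (pa+pb≡1 c i)
  ... | inj₁ (e , _) = inj₁ e
  ... | inj₂ (e , _) = inj₂ e

  pa≡0⇒pb≡1 : ∀ {m M} → Corr m M → ∀ i → M (paP i) ≡ 0 → M (pbP i) ≡ 1
  pa≡0⇒pb≡1 {M = M} c i e = subst (λ a → a + M (pbP i) ≡ 1) e (pa+pb≡1 c i)

  pa≡1⇒pb≡0 : ∀ {m M} → Corr m M → ∀ i → M (paP i) ≡ 1 → M (pbP i) ≡ 0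
  pa≡1⇒pb≡0 {M = M} c i e = suc-injective (subst (λ a → a + M (pbP i) ≡ 1) e (pa+pb≡1 c i))

  pb≥1⇒pa≡0 : ∀ {m M} → Corr m M → ∀ i → 1 ≤ M (pbP i) → M (paP i) ≡ 0
  pb≥1⇒pa≡0 {M = M} c i pb≥1 with m+n≡1⇒ (M (paP i)) (M (pbP i)) (pa+pb≡1 c i)
  ... | inj₁ (e , _) = e
  ... | inj₂ (_ , e) = ⊥-elim (<-irrefl (sym e) pb≥1)

  pa≥1⇒pa≡1 : ∀ {m M} → Corr m M → ∀ i → 1 ≤ M (paP i) → M (paP i) ≡ 1
  pa≥1⇒pa≡1 c i pa≥1 with pa≡0⊎pa≡1 c i
  ... | inj₁ e = ⊥-elim (<-irrefl (sym e) pa≥1)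
  ... | inj₂ e = e

  paired-empty : ∀ {m M} → Corr m M → ∀ i → M (paP i) ≡ 0 → m (sP i) ≡ M (oldP (sP i))
  paired-empty {M = M} c i e = trans (paired c i) (trans (cong (λ a → M (oldP (sP i)) + a * W i) e) (+-identityʳ _))

  corr₀ : Corr (M₀ S) (M₀ SΘ)
  corr₀ = record
    { pa+pb≡1  = λ i → cong₂ _+_ (M₀Θ-pinj (inj₂ (inj₁ i))) (M₀Θ-pinj (inj₂ (inj₂ i)))
    ; unpaired = λ p _ → M₀Θ-pinj (inj₁ p)
    ; paired   = λ i → sym (trans (cong₂ (λ a b → a + b * W i) (M₀Θ-pinj (inj₁ (sP i))) (M₀Θ-pinj (inj₂ (inj₁ i))))
                                  (+-identityʳ _))
    }

  module FireNew (M : Marking NΘ) (i : Fin k) where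
    M' : Marking NΘ
    M' = fire NΘ M (newT i)

    private
      changes : ∀ v {a b} → preV v (inj₂ i) ≡ a → postV (inj₂ i) v ≡ b → M' (pinj v) ≡ M (pinj v) ∸ a + b
      changes v refl refl = fire-tinj M (inj₂ i) v

    pa-same : M' (paP i) ≡ M (paP i) + 1
    pa-same = changes (inj₂ (inj₁ i)) refl (ifDec-yes (i FP.≟ i) refl)

    pa-other : ∀ j → j ≢ i → M' (paP j) ≡ M (paP j)
    pa-other j j≢i = trans (changes (inj₂ (inj₁ j)) refl (ifDec-no (i FP.≟ j) (j≢i ∘ sym))) (+-identityʳ _)

    pb-same : M' (pbP i) ≡ M (pbP i) ∸ 1
    pb-same = trans (changes (inj₂ (inj₂ i)) (ifDec-yes (i FP.≟ i) refl) refl) (+-identityʳ _)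

    pb-other : ∀ j → j ≢ i → M' (pbP j) ≡ M (pbP j)
    pb-other j j≢i = trans (changes (inj₂ (inj₂ j)) (ifDec-no (j FP.≟ i) j≢i) refl) (+-identityʳ _)

    old-same : M' (oldP (sP i)) ≡ M (oldP (sP i)) ∸ W i
    old-same = trans (changes (inj₁ (sP i)) (ifDec-yes (sP i FP.≟ sP i) refl) refl) (+-identityʳ _)

    old-other : ∀ p → sP i ≢ p → M' (oldP p) ≡ M (oldP p)
    old-other p sPi≢p = trans (changes (inj₁ p) (ifDec-no (sP i FP.≟ p) sPi≢p) refl) (+-identityʳ _)

  module FireOld (M : Marking NΘ) (t : T) where
    M' : Marking NΘ
    M' = fire NΘ M (oldT t)

    private
      changes : ∀ v {a b} → preV v (inj₁ t) ≡ a → postV (inj₁ t) v ≡ b → M' (pinj v) ≡ M (pinj v) ∸ a + b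
      changes v refl refl = fire-tinj M (inj₁ t) v

    pa-same : ∀ j → sT j ≡ t → M' (paP j) ≡ M (paP j) ∸ 1
    pa-same j e = trans (changes (inj₂ (inj₁ j)) (ifDec-yes (sT j FP.≟ t) e) refl) (+-identityʳ _)

    pa-other : ∀ j → sT j ≢ t → M' (paP j) ≡ M (paP j)
    pa-other j ne = trans (changes (inj₂ (inj₁ j)) (ifDec-no (sT j FP.≟ t) ne) refl) (+-identityʳ _)

    pb-same : ∀ j → sT j ≡ t → M' (pbP j) ≡ M (pbP j) + 1
    pb-same j e = changes (inj₂ (inj₂ j)) refl (ifDec-yes (sT j FP.≟ t) e)

    pb-other : ∀ j → sT j ≢ t → M' (pbP j) ≡ M (pbP j)
    pb-other j ne = trans (changes (inj₂ (inj₂ j)) refl (ifDec-no (sT j FP.≟ t) ne)) (+-identityʳ _)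

    old-unpaired : ∀ p → Unpaired p → M' (oldP p) ≡ M (oldP p) ∸ pre N p t + post N t p
    old-unpaired p unp = changes (inj₁ p) (preV-unpaired p t unp) refl

    old-paired : ∀ i → M' (oldP (sP i)) ≡ M (oldP (sP i)) + post N t (sP i)
    old-paired i = changes (inj₁ (sP i)) (preV-paired i t) refl

  fireNew : ∀ {m M} → Corr m M → ∀ i → M (paP i) ≡ 0 → W i ≤ m (sP i) →
            Enabled NΘ M (newT i) × Corr m (fire NΘ M (newT i))
            × fire NΘ M (newT i) (paP i) ≡ 1
            × (∀ j → j ≢ i → fire NΘ M (newT i) (paP j) ≡ M (paP j))
  fireNew {m} {M} c i pa≡0 W≤m = enabled-tinj⇐ M (inj₂ i) enabled , corr , pa≡1 , pa-other
    where
    open FireNew M i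
    m≡old : m (sP i) ≡ M (oldP (sP i))
    m≡old = paired-empty c i pa≡0
    W≤old : W i ≤ M (oldP (sP i))
    W≤old = subst (W i ≤_) m≡old W≤m
    pa≡1 : M' (paP i) ≡ 1
    pa≡1 = trans pa-same (cong (_+ 1) pa≡0)
    enabled : ∀ v → preV v (inj₂ i) ≤ M (pinj v)
    enabled (inj₁ p) = ifDec-elim (_≤ M (oldP p)) (sP i FP.≟ p) (λ { refl → W≤old }) (λ _ → z≤n)
    enabled (inj₂ (inj₁ j)) = z≤n
    enabled (inj₂ (inj₂ j)) =
      ifDec-elim (_≤ M (pbP j)) (j FP.≟ i) (λ { refl → ≤-reflexive (sym (pa≡0⇒pb≡1 c i pa≡0)) }) (λ _ → z≤n)
    sum : ∀ j → M' (paP j) + M' (pbP j) ≡ 1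
    sum j with j FP.≟ i
    ... | yes refl = trans (cong₂ _+_ pa-same pb-same) (cong₂ (λ a b → a + 1 + (b ∸ 1)) pa≡0 (pa≡0⇒pb≡1 c i pa≡0))
    ... | no j≢i = trans (cong₂ _+_ (pa-other j j≢i) (pb-other j j≢i)) (pa+pb≡1 c j)
    weighted : ∀ j → m (sP j) ≡ M' (oldP (sP j)) + M' (paP j) * W j
    weighted j with j FP.≟ i
    ... | yes refl = begin
      m (sP i)                              ≡⟨ m≡old ⟩
      M (oldP (sP i))                       ≡⟨ sym (m∸n+n≡m W≤old) ⟩
      M (oldP (sP i)) ∸ W i + W i           ≡⟨ cong (λ z → M (oldP (sP i)) ∸ W i + z) (sym (*-identityˡ (W i))) ⟩
      M (oldP (sP i)) ∸ W i + 1 * W i       ≡⟨ cong₂ (λ a b → a + b * W i) (sym old-same) (sym pa≡1) ⟩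
      M' (oldP (sP i)) + M' (paP i) * W i   ∎
      where open ≡-Reasoning
    ... | no j≢i = trans (paired c j) (cong₂ (λ a b → a + b * W j)
                     (sym (old-other (sP j) (λ e → j≢i (sym (sP-injective i j e))))) (sym (pa-other j j≢i)))
    corr : Corr m M'
    corr = record { pa+pb≡1 = sum ; unpaired = λ p unp → trans (old-other p (unp i)) (unpaired c p unp) ; paired = weighted }

  module _ {m M} (t : T) (c : Corr m M) (full : ∀ i → sT i ≡ t → M (paP i) ≡ 1) where
    open FireOld M t

    fireOld-emptied : ∀ j → sT j ≡ t → M' (paP j) ≡ 0
    fireOld-emptied j e = trans (pa-same j e) (cong (_∸ 1) (full j e))

    fireOld-paired : ∀ j → fire N m t (sP j) ≡ M' (oldP (sP j)) + M' (paP j) * W j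
    fireOld-paired j with sT j FP.≟ t
    ... | yes refl = begin
      m (sP j) ∸ W j + q                      ≡⟨ cong (λ z → z ∸ W j + q) (paired c j) ⟩
      M (oldP (sP j)) + M (paP j) * W j ∸ W j + q
                                              ≡⟨ cong (λ a → M (oldP (sP j)) + a * W j ∸ W j + q) (full j refl) ⟩
      M (oldP (sP j)) + 1 * W j ∸ W j + q     ≡⟨ cong (λ z → M (oldP (sP j)) + z ∸ W j + q) (*-identityˡ (W j)) ⟩
      M (oldP (sP j)) + W j ∸ W j + q         ≡⟨ cong (_+ q) (m+n∸n≡m _ (W j)) ⟩
      M (oldP (sP j)) + q                     ≡⟨ sym (+-identityʳ _) ⟩
      M (oldP (sP j)) + q + 0 * W j           ≡⟨ cong₂ (λ a b → a + b * W j) (sym (old-paired j)) (sym (fireOld-emptied j refl)) ⟩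
      M' (oldP (sP j)) + M' (paP j) * W j     ∎
      where
      open ≡-Reasoning
      q = post N (sT j) (sP j)
    ... | no ne = begin
      m (sP j) ∸ pre N (sP j) t + q           ≡⟨ cong (λ z → m (sP j) ∸ z + q) (pre-sP≡0 j t (λ e → ne (sym e))) ⟩
      m (sP j) + q                            ≡⟨ cong (_+ q) (paired c j) ⟩
      M (oldP (sP j)) + M (paP j) * W j + q   ≡⟨ right-comm (M (oldP (sP j))) (M (paP j) * W j) q ⟩
      M (oldP (sP j)) + q + M (paP j) * W j   ≡⟨ cong₂ (λ a b → a + b * W j) (sym (old-paired j)) (sym (pa-other j ne)) ⟩
      M' (oldP (sP j)) + M' (paP j) * W j     ∎
      where
      open ≡-Reasoning
      q = post N t (sP j)
      right-comm : ∀ a b c → a + b + c ≡ a + c + b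
      right-comm = solve-∀

    fireOld-corr : Corr (fire N m t) M'
    fireOld-corr = record
      { pa+pb≡1  = sum
      ; unpaired = λ p unp → trans (old-unpaired p unp) (cong (λ a → a ∸ pre N p t + post N t p) (unpaired c p unp))
      ; paired   = fireOld-paired
      }
      where
      sum : ∀ j → M' (paP j) + M' (pbP j) ≡ 1
      sum j with sT j FP.≟ t
      ... | no ne = trans (cong₂ _+_ (pa-other j ne) (pb-other j ne)) (pa+pb≡1 c j)
      ... | yes e = trans (cong₂ _+_ (fireOld-emptied j e) (pb-same j e)) (cong (_+ 1) (pa≡1⇒pb≡0 c j (full j e)))

  fireOld : ∀ {m M} t → Corr m M → Enabled N m t → (∀ i → sT i ≡ t → M (paP i) ≡ 1) →
            Enabled NΘ M (oldT t) × Corr (fire N m t) (fire NΘ M (oldT t))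
            × (∀ i → sT i ≡ t → fire NΘ M (oldT t) (paP i) ≡ 0)
            × (∀ i → sT i ≢ t → fire NΘ M (oldT t) (paP i) ≡ M (paP i))
  fireOld {m} {M} t c en full =
    enabled-tinj⇐ M (inj₁ t) enabled , fireOld-corr t c full , fireOld-emptied t c full , FireOld.pa-other M t
    where
    enabled : ∀ v → preV v (inj₁ t) ≤ M (pinj v)
    enabled (inj₁ p) with paired? p
    ... | inj₁ unp = subst₂ _≤_ (sym (preV-unpaired p t unp)) (sym (unpaired c p unp)) (en p)
    ... | inj₂ (i , refl) = subst (_≤ M (oldP (sP i))) (sym (preV-paired i t)) z≤n
    enabled (inj₂ (inj₁ j)) =
      ifDec-elim (_≤ M (paP j)) (sT j FP.≟ t) (λ e → ≤-reflexive (sym (full j e))) (λ _ → z≤n)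
    enabled (inj₂ (inj₂ j)) = z≤n

  enabledNew⇒ : ∀ {m M} i → Corr m M → Enabled NΘ M (newT i) → M (paP i) ≡ 0 × W i ≤ m (sP i)
  enabledNew⇒ {m} {M} i c en = pb≥1⇒pa≡0 c i pb≥1 , ≤-trans W≤old (subst (M (oldP (sP i)) ≤_) (sym (paired c i)) (m≤m+n _ _))
    where
    en′ = enabled-tinj⇒ M (inj₂ i) en
    pb≥1 : 1 ≤ M (pbP i)
    pb≥1 = subst (_≤ M (pbP i)) (ifDec-yes (i FP.≟ i) refl) (en′ (inj₂ (inj₂ i)))
    W≤old : W i ≤ M (oldP (sP i))
    W≤old = subst (_≤ M (oldP (sP i))) (ifDec-yes (sP i FP.≟ sP i) refl) (en′ (inj₁ (sP i)))

  enabledOld⇒ : ∀ {m M} t → Corr m M → Enabled NΘ M (oldT t) → Enabled N m t × (∀ i → sT i ≡ t → M (paP i) ≡ 1)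
  enabledOld⇒ {m} {M} t c en = enabled , full
    where
    en′ = enabled-tinj⇒ M (inj₁ t) en
    full : ∀ i → sT i ≡ t → M (paP i) ≡ 1
    full i e = pa≥1⇒pa≡1 c i (subst (_≤ M (paP i)) (ifDec-yes (sT i FP.≟ t) e) (en′ (inj₂ (inj₁ i))))
    enabled : Enabled N m t
    enabled p with paired? p
    ... | inj₁ unp = subst₂ _≤_ (preV-unpaired p t unp) (unpaired c p unp) (en′ (inj₁ p))
    ... | inj₂ (i , refl) with t FP.≟ sT i
    ...   | no ne = subst (_≤ m (sP i)) (sym (pre-sP≡0 i t ne)) z≤n
    ...   | yes refl = begin
      W i                                   ≡⟨ sym (*-identityˡ (W i)) ⟩
      1 * W i                               ≤⟨ m≤n+m _ (M (oldP (sP i))) ⟩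
      M (oldP (sP i)) + 1 * W i             ≡⟨ cong (λ a → M (oldP (sP i)) + a * W i) (sym (full i refl)) ⟩
      M (oldP (sP i)) + M (paP i) * W i     ≡⟨ sym (paired c i) ⟩
      m (sP i)                              ∎
      where open ≤-Reasoning

  fireNews : ∀ {m M} → Corr m M → (L : List (Fin k)) → Unique L →
             (∀ i → i ∈ L → M (paP i) ≡ 0 × W i ≤ m (sP i)) →
             ∃ λ M' → Fires NΘ M (map newT L) M' × Corr m M'
                      × (∀ i → i ∈ L → M' (paP i) ≡ 1) × (∀ i → i ∉ L → M' (paP i) ≡ M (paP i))
  fireNews c [] _ _ = _ , done , c , (λ _ ()) , (λ _ _ → refl)
  fireNews {m} {M} c (j ∷ L) (j∉L ∷ u) ready =
    let (pa≡0 , W≤m) = ready j (here refl)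
        (en , c₁ , paj≡1 , pa-other) = fireNew c j pa≡0 W≤m
        (M' , fs , c' , inL , notL) = fireNews c₁ L u (λ i i∈ → trans (pa-other i (j≢ i∈)) (proj₁ (ready i (there i∈)))
                                                               , proj₂ (ready i (there i∈)))
    in M' , step en fs , c' , inL′ M' inL notL paj≡1 , notL′ M' notL pa-other
    where
    j≢ : ∀ {i} → i ∈ L → i ≢ j
    j≢ i∈ i≡j = All.lookup j∉L i∈ (sym i≡j)
    M₁ = fire NΘ M (newT j)
    inL′ : ∀ M' → (∀ i → i ∈ L → M' (paP i) ≡ 1) → (∀ i → i ∉ L → M' (paP i) ≡ M₁ (paP i)) →
           M₁ (paP j) ≡ 1 → ∀ i → i ∈ j ∷ L → M' (paP i) ≡ 1
    inL′ M' inL notL e i (here refl) = trans (notL j (λ j∈ → j≢ j∈ refl)) e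
    inL′ M' inL notL e i (there i∈) = inL i i∈
    notL′ : ∀ M' → (∀ i → i ∉ L → M' (paP i) ≡ M₁ (paP i)) →
            (∀ i → i ≢ j → M₁ (paP i) ≡ M (paP i)) → ∀ i → i ∉ j ∷ L → M' (paP i) ≡ M (paP i)
    notL′ M' notL other i i∉ = trans (notL i (λ i∈ → i∉ (there i∈))) (other i (λ e → i∉ (here e)))

  fireNewsThenOld : ∀ {m M} t → Corr m M → Enabled N m t → (L : List (Fin k)) → Unique L →
     (∀ j → j ∈ L → sT j ≡ t × M (paP j) ≡ 0) → (∀ j → sT j ≡ t → j ∉ L → M (paP j) ≡ 1) →
     ∃ λ M₁ → Fires NΘ M (map newT L) M₁ × Enabled NΘ M₁ (oldT t)
              × Corr (fire N m t) (fire NΘ M₁ (oldT t))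
              × (∀ j → sT j ≡ t → fire NΘ M₁ (oldT t) (paP j) ≡ 0)
              × (∀ j → sT j ≢ t → fire NΘ M₁ (oldT t) (paP j) ≡ M (paP j))
  fireNewsThenOld {m} {M} t c en L u pending others =
    let (M₁ , fs , c₁ , inL , notL) = fireNews c L u (λ i i∈ → proj₂ (pending i i∈) , W≤m i (proj₁ (pending i i∈)))
        (en₁ , c' , emptied , untouched) = fireOld t c₁ en (full M₁ inL notL)
    in M₁ , fs , en₁ , c' , emptied , λ j ne → trans (untouched j ne) (notL j (λ j∈ → ne (proj₁ (pending j j∈))))
    where
    W≤m : ∀ i → sT i ≡ t → W i ≤ m (sP i)
    W≤m i refl = en (sP i)
    full : ∀ M₁ → (∀ i → i ∈ L → M₁ (paP i) ≡ 1) → (∀ i → i ∉ L → M₁ (paP i) ≡ M (paP i)) →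
           ∀ i → sT i ≡ t → M₁ (paP i) ≡ 1
    full M₁ inL notL i e with Any.any? (i FP.≟_) L
    ... | yes i∈ = inL i i∈
    ... | no i∉ = trans (notL i i∉) (others i e i∉)

  Clean : Marking NΘ → Set
  Clean M = ∀ i → M (paP i) ≡ 0

  clean₀ : Clean (M₀ SΘ)
  clean₀ i = M₀Θ-pinj (inj₂ (inj₁ i))

  newTransPre⇒ : ∀ t i → InNewTransPre t i → sT i ≡ t
  newTransPre⇒ t i (q , pre>0 , post>0) with placeView q
  ... | old p with () ← post-pos (inj₂ i) (inj₁ p) post>0
  ... | pb j with () ← post-pos (inj₂ i) (inj₂ (inj₂ j)) post>0
  ... | pa j with refl ← ifDec-pos (i FP.≟ j) (post-pos (inj₂ i) (inj₂ (inj₁ j)) post>0) =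
    ifDec-pos (sT i FP.≟ t) (pre-pos (inj₂ (inj₁ i)) (inj₁ t) pre>0)

  newTransPre⇐ : ∀ t i → sT i ≡ t → InNewTransPre t i
  newTransPre⇐ t i e = paP i
    , subst (0 <_) (sym (trans (pre-pinj-tinj (inj₂ (inj₁ i)) (inj₁ t)) (ifDec-yes (sT i FP.≟ t) e))) (s≤s z≤n)
    , subst (0 <_) (sym (trans (post-tinj-pinj (inj₂ i) (inj₂ (inj₁ i))) (ifDec-yes (i FP.≟ i) refl))) (s≤s z≤n)

  newTransPre : T → List (Fin k)
  newTransPre t = filter (inNewTransPre? t) (allFin k)

  newTransPre-unique : ∀ t → Unique (newTransPre t)
  newTransPre-unique t = UP.filter⁺ (inNewTransPre? t) (UP.allFin⁺ k)

  ∈newTransPre⇔ : ∀ t i → (i ∈ newTransPre t → sT i ≡ t) × (sT i ≡ t → i ∈ newTransPre t)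
  ∈newTransPre⇔ t i = (λ i∈ → newTransPre⇒ t i (proj₂ (MP.∈-filter⁻ (inNewTransPre? t) {xs = allFin k} i∈)))
                    , (λ e → MP.∈-filter⁺ (inNewTransPre? t) (MP.∈-allFin i) (newTransPre⇐ t i e))

  simulateθ : ∀ {m M α e} → Corr m M → Clean M → Fires N m α e →
              ∃ λ E → Fires NΘ M (θ α) E × Corr e E × Clean E
  simulateθ c cl done = _ , done , c , cl
  simulateθ {M = M} c cl (step {t = t} en fs) =
    let (M₁ , fs₁ , en₁ , c₁ , emptied , untouched) =
          fireNewsThenOld t c en (newTransPre t) (newTransPre-unique t)
            (λ j j∈ → proj₁ (∈newTransPre⇔ t j) j∈ , cl j)
            (λ j e j∉ → ⊥-elim (j∉ (proj₂ (∈newTransPre⇔ t j) e)))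
        (E , fsE , cE , clE) = simulateθ c₁ (clean (fire NΘ M₁ (oldT t)) emptied untouched) fs
    in E , fires-++ fs₁ (step en₁ fsE) , cE , clE
    where
    clean : ∀ M' → (∀ j → sT j ≡ t → M' (paP j) ≡ 0) → (∀ j → sT j ≢ t → M' (paP j) ≡ M (paP j)) → Clean M'
    clean M' emptied untouched j with sT j FP.≟ t
    ... | yes e = emptied j e
    ... | no ne = trans (untouched j ne) (cl j)

  θ-feasible : ∀ α → Feasible S α → Feasible SΘ (θ α)
  θ-feasible α (e , fs) = let (E , fsE , _) = simulateθ corr₀ clean₀ fs in E , fsE

  Pending : Marking NΘ → T → Fin k → Set
  Pending M t j = sT j ≡ t × M (paP j) ≡ 0

  pending? : ∀ M t j → Dec (Pending M t j)
  pending? M t j = (sT j FP.≟ t) ×-dec (M (paP j) ℕ.≟ 0)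

  fireOld-simulated : ∀ {m M} t → Corr m M → Enabled N m t →
     ∃ λ M₁ → Fires NΘ M (map newT (filter (pending? M t) (allFin k))) M₁ × Enabled NΘ M₁ (oldT t)
              × Corr (fire N m t) (fire NΘ M₁ (oldT t))
              × (∀ j → sT j ≡ t → fire NΘ M₁ (oldT t) (paP j) ≡ 0)
              × (∀ j → sT j ≢ t → fire NΘ M₁ (oldT t) (paP j) ≡ M (paP j))
  fireOld-simulated {M = M} t c en =
    fireNewsThenOld t c en L (UP.filter⁺ (pending? M t) (UP.allFin⁺ k))
      (λ j j∈ → proj₂ (MP.∈-filter⁻ (pending? M t) {xs = allFin k} j∈)) full
    where
    L = filter (pending? M t) (allFin k)
    full : ∀ j → sT j ≡ t → j ∉ L → M (paP j) ≡ 1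
    full j e j∉ with pa≡0⊎pa≡1 c j
    ... | inj₂ pa≡1 = pa≡1
    ... | inj₁ pa≡0 = ⊥-elim (j∉ (MP.∈-filter⁺ (pending? M t) (MP.∈-allFin j) (e , pa≡0)))

  simulate : ∀ {m M σ e} → Corr m M → Fires N m σ e →
             ∃₂ λ σ' E → Fires NΘ M σ' E × Corr e E
                         × (∀ j → sT j ∈ σ → E (paP j) ≡ 0) × (∀ j → sT j ∉ σ → E (paP j) ≡ M (paP j))
  simulate c done = _ , _ , done , c , (λ _ ()) , (λ _ _ → refl)
  simulate {M = M} c (step {t = t} {σ = σ} en fs) =
    let (M₁ , fs₁ , en₁ , c₁ , emptied , untouched) = fireOld-simulated t c en
        (σ' , E , fsE , cE , inσ , notσ) = simulate c₁ fs
    in _ , E , fires-++ fs₁ (step en₁ fsE) , cE , in-t∷σ E (fire NΘ M₁ (oldT t)) inσ notσ emptied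
       , λ j j∉ → trans (notσ j (λ j∈ → j∉ (there j∈))) (untouched j (λ e → j∉ (here e)))
    where
    in-t∷σ : ∀ E M₂ → (∀ j → sT j ∈ σ → E (paP j) ≡ 0) → (∀ j → sT j ∉ σ → E (paP j) ≡ M₂ (paP j)) →
             (∀ j → sT j ≡ t → M₂ (paP j) ≡ 0) → ∀ j → sT j ∈ t ∷ σ → E (paP j) ≡ 0
    in-t∷σ E M₂ inσ notσ emptied j (there j∈) = inσ j j∈
    in-t∷σ E M₂ inσ notσ emptied j (here e) with Any.any? (sT j FP.≟_) σ
    ... | yes j∈ = inσ j j∈
    ... | no j∉ = trans (notσ j j∉) (emptied j e)

  project : List (Trans NΘ) → List T
  project [] = []
  project (x ∷ β) with transView x
  ... | old t = t ∷ project β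
  ... | new i = project β

  simulateBack : ∀ {m M β E} → Corr m M → Fires NΘ M β E → ∃ λ e → Fires N m (project β) e × Corr e E
  simulateBack c done = _ , done , c
  simulateBack c (step {t = x} en fs) with transView x
  ... | old t =
    let (en′ , full) = enabledOld⇒ t c en
        (_ , c′ , _) = fireOld t c en′ full
        (e , fs′ , c″) = simulateBack c′ fs
    in e , step en′ fs′ , c″
  ... | new i =
    let (pa≡0 , W≤m) = enabledNew⇒ i c en
    in simulateBack (proj₁ (proj₂ (fireNew c i pa≡0 W≤m))) fs

  reachable-corr : ∀ {M} → Reachable SΘ M → ∃ λ m → Reachable S m × Corr m M
  reachable-corr (β , fs) = let (m , fs′ , c) = simulateBack corr₀ fs in m , (project β , fs′) , c

  dead-corr : ∀ {m M} → Corr m M → (∀ x → ¬ Enabled NΘ M x) → ∀ t → ¬ Enabled N m t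
  dead-corr {m} {M} c dead t en with FP.any? (pending? M t)
  ... | yes (i , refl , pa≡0) = dead (newT i) (proj₁ (fireNew c i pa≡0 (en (sP i))))
  ... | no none = dead (oldT t) (proj₁ (fireOld t c en full))
    where
    full : ∀ i → sT i ≡ t → M (paP i) ≡ 1
    full i e with pa≡0⊎pa≡1 c i
    ... | inj₂ pa≡1 = pa≡1
    ... | inj₁ pa≡0 = ⊥-elim (none (i , e , pa≡0))

  -- Firing every t_i enabled at a dead marking of S leaves a dead marking of S^Θ.
  deadlock-lift : ∀ {m M} → Corr m M → (∀ t → ¬ Enabled N m t) →
                  ∃₂ λ σ M' → Fires NΘ M σ M' × (∀ x → ¬ Enabled NΘ M' x)
  deadlock-lift {m} {M} c dead =
    let (M' , fs , c' , inL , notL) = fireNews c L (UP.filter⁺ ready? (UP.allFin⁺ k)) (λ i i∈ → ready⇒ i∈)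
    in _ , M' , fs , dead′ c' inL notL
    where
    ready? : ∀ i → Dec (M (paP i) ≡ 0 × W i ≤ m (sP i))
    ready? i = (M (paP i) ℕ.≟ 0) ×-dec (W i ≤? m (sP i))
    L = filter ready? (allFin k)
    ready⇒ : ∀ {i} → i ∈ L → M (paP i) ≡ 0 × W i ≤ m (sP i)
    ready⇒ i∈ = proj₂ (MP.∈-filter⁻ ready? {xs = allFin k} i∈)
    dead′ : ∀ {M'} → Corr m M' → (∀ i → i ∈ L → M' (paP i) ≡ 1) → (∀ i → i ∉ L → M' (paP i) ≡ M (paP i)) →
            ∀ x → ¬ Enabled NΘ M' x
    dead′ c' inL notL x en with transView x
    ... | old t = dead t (proj₁ (enabledOld⇒ t c' en))
    ... | new i with enabledNew⇒ i c' en | ready? i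
    ...   | pa≡0 , _ | yes r = 0≢1+n (trans (sym pa≡0) (inL i (MP.∈-filter⁺ ready? (MP.∈-allFin i) r)))
    ...   | pa≡0 , W≤m | no ¬r = ¬r (trans (sym (notL i (λ i∈ → ¬r (ready⇒ i∈)))) pa≡0 , W≤m)

  deadlockable⇔ : Deadlockable SΘ ⇔ Deadlockable S
  deadlockable⇔ = mk⇔
    (λ (M , reach , dead) → let (m , reach′ , c) = reachable-corr reach in m , reach′ , dead-corr c dead)
    (λ (m , (α , fs) , dead) →
      let (E , fsE , cE , _) = simulateθ corr₀ clean₀ fs
          (σ , M' , fs′ , dead′) = deadlock-lift cE dead
      in M' , (θ α ++ σ , fires-++ fsE fs′) , dead′)

  underlying : Trans NΘ → T
  underlying x with transView x
  ... | old t = t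
  ... | new i = sT i

  enable : ∀ {m E} x → Corr m E → Enabled N m (underlying x) → (∀ j → sT j ≡ underlying x → E (paP j) ≡ 0) →
           ∃₂ λ σ M' → Fires NΘ E σ M' × Enabled NΘ M' x
  enable x c en empty with transView x
  ... | old t = let (M₁ , fs₁ , en₁ , _) = fireOld-simulated t c en in _ , M₁ , fs₁ , en₁
  ... | new i = [] , _ , done , proj₁ (fireNew c i (empty i refl) (en (sP i)))

  -- To enable t_i, the underlying transition is fired once more so that p_a^i is empty.
  live⇔ : Live SΘ ⇔ Live S
  live⇔ = mk⇔ to from
    where
    to : Live SΘ → Live S
    to liveΘ t m (α , fs) =
      let (E , fsE , cE , _) = simulateθ corr₀ clean₀ fs
          (σ , M' , fs′ , en′) = liveΘ (oldT t) E (θ α , fsE)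
          (e , fsS , c′) = simulateBack cE fs′
      in project σ , e , fsS , proj₁ (enabledOld⇒ t c′ en′)
    from : Live S → Live SΘ
    from liveS x M reach =
      let u = underlying x
          (m , (α , fsm) , c) = reachable-corr reach
          (σ₁ , m₁ , fs₁ , en₁) = liveS u m (α , fsm)
          (σ₂ , m₂ , fs₂ , en₂) = liveS u (fire N m₁ u) (α ++ σ₁ ++ u ∷ [] , fires-++ fsm (fires-++ fs₁ (step en₁ done)))
          (σ′ , E , fsE , cE , emptied , _) = simulate c (fires-++ fs₁ (step en₁ fs₂))
          (σ″ , M' , fs″ , en″) = enable x cE en₂ (λ j e → emptied j (MP.∈-++⁺ʳ σ₁ (here e)))
      in σ′ ++ σ″ , M' , fires-++ fsE fs″ , en″

  θ̂-feasible : ∀ {M} β {E} → Fires NΘ M β E → ∃ λ E' → Fires NΘ M (θ̂ β) E'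
  θ̂-feasible [] done = _ , done
  θ̂-feasible {M} (x ∷ β) (step en fs) with isNew? x ×-dec ¬? (Any.any? (postPost? x) β)
  ... | no _ = let (E' , fs′) = θ̂-feasible β fs in E' , step en fs′
  ... | yes (_ , unconsumed) = θ̂-feasible β (proj₂ (fires-covered fs covers))
    where
    -- x only removes tokens, except from places that β never consumes from.
    covers : Covers {NΘ} M (fire NΘ M x) β
    covers p with post NΘ x p in eq
    ... | zero = inj₁ (≤-trans (≤-reflexive (+-identityʳ _)) (m∸n≤m (M p) (pre NΘ p x)))
    ... | suc _ = inj₂ (All.tabulate λ {y} y∈ → pre≡0 y y∈)
      where
      pre≡0 : ∀ y → y ∈ β → pre NΘ p y ≡ 0
      pre≡0 y y∈ with pre NΘ p y in eq₂
      ... | zero = refl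
      ... | suc _ = ⊥-elim (unconsumed (Any.map (λ { refl → p , subst (0 <_) (sym eq) (s≤s z≤n)
                                                              , subst (0 <_) (sym eq₂) (s≤s z≤n) }) y∈))

  postPost-newT⇒ : ∀ i y → PostPost (newT i) y → y ≡ oldT (sT i)
  postPost-newT⇒ i y (q , post>0 , pre>0) with placeView q | transView y
  ... | old p | _ with () ← post-pos (inj₂ i) (inj₁ p) post>0
  ... | pb j | _ with () ← post-pos (inj₂ i) (inj₂ (inj₂ j)) post>0
  ... | pa j | new l with () ← pre-pos (inj₂ (inj₁ j)) (inj₂ l) pre>0
  ... | pa j | old t with refl ← ifDec-pos (i FP.≟ j) (post-pos (inj₂ i) (inj₂ (inj₁ j)) post>0) =
    cong oldT (sym (ifDec-pos (sT i FP.≟ t) (pre-pos (inj₂ (inj₁ i)) (inj₁ t) pre>0)))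

  postPost-newT⇐ : ∀ i → PostPost (newT i) (oldT (sT i))
  postPost-newT⇐ i = let (q , pre>0 , post>0) = newTransPre⇐ (sT i) i refl in q , post>0 , pre>0

  parikh-θ̂-≢ : ∀ x β i → x ≢ newT i → parikh (θ̂ (x ∷ β)) (newT i) ≡ parikh (θ̂ β) (newT i)
  parikh-θ̂-≢ x β i x≢ with isNew? x ×-dec ¬? (Any.any? (postPost? x) β)
  ... | yes _ = refl
  ... | no _ = parikh-∷-≢ (newT i) x (θ̂ β) x≢

  parikh-θ̂-kept : ∀ β i → oldT (sT i) ∈ β → parikh (θ̂ (newT i ∷ β)) (newT i) ≡ suc (parikh (θ̂ β) (newT i))
  parikh-θ̂-kept β i o∈ with isNew? (newT i) ×-dec ¬? (Any.any? (postPost? (newT i)) β)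
  ... | yes (_ , unconsumed) = ⊥-elim (unconsumed (Any.map (λ { refl → postPost-newT⇐ i }) o∈))
  ... | no _ = parikh-∷-≡ (newT i) (θ̂ β)

  parikh-θ̂-dropped : ∀ β i → oldT (sT i) ∉ β → parikh (θ̂ (newT i ∷ β)) (newT i) ≡ parikh (θ̂ β) (newT i)
  parikh-θ̂-dropped β i o∉ with isNew? (newT i) ×-dec ¬? (Any.any? (postPost? (newT i)) β)
  ... | yes _ = refl
  ... | no kept = ⊥-elim (kept ((i , refl) , λ consumed → o∉ (Any.map (λ {y} pp → sym (postPost-newT⇒ i y pp)) consumed)))

  -- An occurrence of t_i survives in θ̂ β iff a later t consumes it; p_a^i accounts for a pending one.
  parikh-θ̂-newT : ∀ {m M β E} i → Corr m M → Fires NΘ M β E →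
                  parikh (θ̂ β) (newT i) ≡ parikh β (oldT (sT i)) ∸ M (paP i)
  parikh-θ̂-newT {M = M} i c done = sym (0∸n≡0 (M (paP i)))
  parikh-θ̂-newT {M = M} i c (step {t = x} {σ = β} en fs) with transView x
  ... | old t with enabledOld⇒ t c en
  ...   | en′ , full with fireOld t c en′ full
  ...     | _ , c′ , emptied , untouched with sT i FP.≟ t
  ...       | yes refl = begin
    parikh (θ̂ (o ∷ β)) (newT i)                        ≡⟨ parikh-θ̂-≢ o β i (oldT≢newT (sT i) i) ⟩
    parikh (θ̂ β) (newT i)                              ≡⟨ parikh-θ̂-newT i c′ fs ⟩
    parikh β o ∸ fire NΘ M o (paP i)                    ≡⟨ cong (parikh β o ∸_) (emptied i refl) ⟩
    parikh β o                                          ≡⟨ cong₂ _∸_ (sym (parikh-∷-≡ o β)) (sym (full i refl)) ⟩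
    parikh (o ∷ β) o ∸ M (paP i)                        ∎
    where
    open ≡-Reasoning
    o = oldT (sT i)
  ...       | no sTi≢t = begin
    parikh (θ̂ (oldT t ∷ β)) (newT i)                   ≡⟨ parikh-θ̂-≢ (oldT t) β i (oldT≢newT t i) ⟩
    parikh (θ̂ β) (newT i)                              ≡⟨ parikh-θ̂-newT i c′ fs ⟩
    parikh β o ∸ fire NΘ M (oldT t) (paP i)             ≡⟨ cong₂ _∸_ (sym (parikh-∷-≢ o (oldT t) β t≢)) (untouched i sTi≢t) ⟩
    parikh (oldT t ∷ β) o ∸ M (paP i)                   ∎
    where
    open ≡-Reasoning
    o = oldT (sT i)
    t≢ : oldT t ≢ o
    t≢ e = sTi≢t (sym (oldT-injective t (sT i) e))
  parikh-θ̂-newT {M = M} i c (step {σ = β} en fs) | new j with enabledNew⇒ j c en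
  ... | pa≡0 , W≤m with fireNew c j pa≡0 W≤m
  ...   | _ , c′ , pa≡1 , pa-other with j FP.≟ i
  ...     | no j≢i = begin
    parikh (θ̂ (newT j ∷ β)) (newT i)                   ≡⟨ parikh-θ̂-≢ (newT j) β i (λ e → j≢i (newT-injective j i e)) ⟩
    parikh (θ̂ β) (newT i)                              ≡⟨ parikh-θ̂-newT i c′ fs ⟩
    parikh β o ∸ fire NΘ M (newT j) (paP i)             ≡⟨ cong₂ _∸_ (sym (parikh-∷-≢ o (newT j) β new≢o))
                                                                    (pa-other i (λ e → j≢i (sym e))) ⟩
    parikh (newT j ∷ β) o ∸ M (paP i)                   ∎
    where
    open ≡-Reasoning
    o = oldT (sT i)
    new≢o : newT j ≢ o
    new≢o e = oldT≢newT (sT i) j (sym e)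
  ...     | yes refl = trans (count (Any.any? (o FP.≟_) β))
                             (sym (trans (cong (parikh (newT i ∷ β) o ∸_) pa≡0) (parikh-∷-≢ o (newT i) β new≢o)))
    where
    o = oldT (sT i)
    new≢o : newT i ≢ o
    new≢o e = oldT≢newT (sT i) i (sym e)
    ih : parikh (θ̂ β) (newT i) ≡ parikh β o ∸ 1
    ih = trans (parikh-θ̂-newT i c′ fs) (cong (parikh β o ∸_) pa≡1)
    count : Dec (o ∈ β) → parikh (θ̂ (newT i ∷ β)) (newT i) ≡ parikh β o
    count (yes o∈) = trans (parikh-θ̂-kept β i o∈) (trans (cong suc ih) (suc-pred _ {{>-nonZero (parikh-∈ β o o∈)}}))
    count (no o∉) = trans (parikh-θ̂-dropped β i o∉) (trans ih (trans (cong (_∸ 1) none) (sym none)))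
      where none = parikh-∉ β o o∉

  parikh-map-newT-oldT : ∀ L u → parikh (map newT L) (oldT u) ≡ 0
  parikh-map-newT-oldT L u = parikh-∉ (map newT L) (oldT u) λ o∈ →
    let (j , _ , e) = MP.∈-map⁻ newT o∈ in oldT≢newT u j e

  parikh-newTransPre : ∀ t i → parikh (newTransPre t) i ≡ ifDec (t FP.≟ sT i) 1 0
  parikh-newTransPre t i with t FP.≟ sT i
  ... | yes e = parikh-unique (newTransPre t) i (newTransPre-unique t) (proj₂ (∈newTransPre⇔ t i) (sym e))
  ... | no ne = parikh-∉ (newTransPre t) i (λ i∈ → ne (sym (proj₁ (∈newTransPre⇔ t i) i∈)))

  parikh-θ-oldT : ∀ α u → parikh (θ α) (oldT u) ≡ parikh α u
  parikh-θ-oldT [] u = refl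
  parikh-θ-oldT (t ∷ α) u = begin
    parikh (map newT (newTransPre t) ++ oldT t ∷ θ α) (oldT u)
      ≡⟨ parikh-++ (map newT (newTransPre t)) (oldT t ∷ θ α) (oldT u) ⟩
    parikh (map newT (newTransPre t)) (oldT u) + parikh (oldT t ∷ θ α) (oldT u)
      ≡⟨ cong (_+ parikh (oldT t ∷ θ α) (oldT u)) (parikh-map-newT-oldT (newTransPre t) u) ⟩
    parikh (oldT t ∷ θ α) (oldT u)
      ≡⟨ parikh-∷ (oldT t) (oldT u) (θ α) ⟩
    ifDec (oldT t FP.≟ oldT u) 1 0 + parikh (θ α) (oldT u)
      ≡⟨ cong₂ _+_ (ifDec-⇔ (oldT-injective t u) (cong oldT) (oldT t FP.≟ oldT u) (t FP.≟ u)) (parikh-θ-oldT α u) ⟩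
    ifDec (t FP.≟ u) 1 0 + parikh α u
      ≡⟨ sym (parikh-∷ t u α) ⟩
    parikh (t ∷ α) u ∎
    where open ≡-Reasoning

  parikh-θ-newT : ∀ α i → parikh (θ α) (newT i) ≡ parikh α (sT i)
  parikh-θ-newT [] i = refl
  parikh-θ-newT (t ∷ α) i = begin
    parikh (map newT (newTransPre t) ++ oldT t ∷ θ α) (newT i)
      ≡⟨ parikh-++ (map newT (newTransPre t)) (oldT t ∷ θ α) (newT i) ⟩
    parikh (map newT (newTransPre t)) (newT i) + parikh (oldT t ∷ θ α) (newT i)
      ≡⟨ cong₂ _+_ (parikh-map newT newT-injective (newTransPre t) i) (parikh-∷-≢ (newT i) (oldT t) (θ α) (oldT≢newT t i)) ⟩
    parikh (newTransPre t) i + parikh (θ α) (newT i)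
      ≡⟨ cong₂ _+_ (parikh-newTransPre t i) (parikh-θ-newT α i) ⟩
    ifDec (t FP.≟ sT i) 1 0 + parikh α (sT i)
      ≡⟨ sym (parikh-∷ t (sT i) α) ⟩
    parikh (t ∷ α) (sT i) ∎
    where open ≡-Reasoning

  parikh-θ̂-oldT : ∀ β u → parikh (θ̂ β) (oldT u) ≡ parikh β (oldT u)
  parikh-θ̂-oldT [] u = refl
  parikh-θ̂-oldT (x ∷ β) u with isNew? x ×-dec ¬? (Any.any? (postPost? x) β)
  ... | yes ((j , refl) , _) = trans (parikh-θ̂-oldT β u) (sym (parikh-∷-≢ (oldT u) (newT j) β (λ e → oldT≢newT u j (sym e))))
  ... | no _ = trans (parikh-∷ x (oldT u) (θ̂ β))
                     (trans (cong (λ n → ifDec (x FP.≟ oldT u) 1 0 + n) (parikh-θ̂-oldT β u)) (sym (parikh-∷ x (oldT u) β)))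

  parikh-project : ∀ β u → parikh β (oldT u) ≡ parikh (project β) u
  parikh-project [] u = refl
  parikh-project (x ∷ β) u with transView x
  ... | new j = trans (parikh-∷-≢ (oldT u) (newT j) β (λ e → oldT≢newT u j (sym e))) (parikh-project β u)
  ... | old t = trans (parikh-∷ (oldT t) (oldT u) β)
    (trans (cong₂ _+_ (ifDec-⇔ (oldT-injective t u) (cong oldT) (oldT t FP.≟ oldT u) (t FP.≟ u)) (parikh-project β u))
           (sym (parikh-∷ t u (project β))))

  θ̂-reduction : ∀ β' → Feasible SΘ β' →
                Feasible SΘ (θ̂ β')
                × ∃ λ α → Feasible S α × Feasible SΘ (θ α) × (∀ x → parikh (θ α) x ≡ parikh (θ̂ β') x)
  θ̂-reduction β' (E , fs) = θ̂-feasible β' fs , α , feasible , θ-feasible α feasible , same-parikh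
    where
    α = project β'
    feasible : Feasible S α
    feasible = let (e , fs′ , _) = simulateBack corr₀ fs in e , fs′
    same-parikh : ∀ x → parikh (θ α) x ≡ parikh (θ̂ β') x
    same-parikh x with transView x
    ... | old u = trans (parikh-θ-oldT α u) (sym (trans (parikh-θ̂-oldT β' u) (parikh-project β' u)))
    ... | new i = trans (parikh-θ-newT α i) (sym (begin
      parikh (θ̂ β') (newT i)                          ≡⟨ parikh-θ̂-newT i corr₀ fs ⟩
      parikh β' (oldT (sT i)) ∸ M₀ SΘ (paP i)         ≡⟨ cong (parikh β' (oldT (sT i)) ∸_) (clean₀ i) ⟩
      parikh β' (oldT (sT i))                         ≡⟨ parikh-project β' (sT i) ⟩
      parikh α (sT i)                                 ∎))
      where open ≡-Reasoning

module Θ-Structure (S : System) where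
  open Θ-Basics S

  SoleOutput SoleInput : Fin (np NΘ) → Set
  SoleOutput q = ∃ λ y → ∀ x → 0 < pre NΘ q x → x ≡ y
  SoleInput q = ∃ λ y → ∀ x → 0 < post NΘ x q → x ≡ y

  outputs-unpaired : ∀ p → Unpaired p → ∀ x → 0 < pre NΘ (oldP p) x →
                     ∃ λ t → x ≡ oldT t × pre NΘ (oldP p) x ≡ pre N p t
  outputs-unpaired p unp x pos with transView x
  ... | old t = t , refl , trans (pre-pinj-tinj (inj₁ p) (inj₁ t)) (preV-unpaired p t unp)
  ... | new j = ⊥-elim (unp j (ifDec-pos (sP j FP.≟ p) (pre-pos (inj₁ p) (inj₂ j) pos)))

  outputs : ∀ q → (∃ λ p → q ≡ oldP p × Unpaired p) ⊎ SoleOutput q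
  outputs q with placeView q
  ... | old p with paired? p
  ...   | inj₁ unp = inj₁ (p , refl , unp)
  ...   | inj₂ (i , refl) = inj₂ (newT i , sole)
    where
    sole : ∀ x → 0 < pre NΘ (oldP (sP i)) x → x ≡ newT i
    sole x pos with transView x
    ... | old t with () ← subst (0 <_) (preV-paired i t) (pre-pos (inj₁ (sP i)) (inj₁ t) pos)
    ... | new j = cong newT (sP-injective j i (ifDec-pos (sP j FP.≟ sP i) (pre-pos (inj₁ (sP i)) (inj₂ j) pos)))
  outputs q | pa i = inj₂ (oldT (sT i) , sole)
    where
    sole : ∀ x → 0 < pre NΘ (paP i) x → x ≡ oldT (sT i)
    sole x pos with transView x
    ... | old t = cong oldT (sym (ifDec-pos (sT i FP.≟ t) (pre-pos (inj₂ (inj₁ i)) (inj₁ t) pos)))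
    ... | new j with () ← pre-pos (inj₂ (inj₁ i)) (inj₂ j) pos
  outputs q | pb i = inj₂ (newT i , sole)
    where
    sole : ∀ x → 0 < pre NΘ (pbP i) x → x ≡ newT i
    sole x pos with transView x
    ... | old t with () ← pre-pos (inj₂ (inj₂ i)) (inj₁ t) pos
    ... | new j = cong newT (sym (ifDec-pos (i FP.≟ j) (pre-pos (inj₂ (inj₂ i)) (inj₂ j) pos)))

  inputs-old : ∀ p x → 0 < post NΘ x (oldP p) → ∃ λ t → x ≡ oldT t × post NΘ x (oldP p) ≡ post N t p
  inputs-old p x pos with transView x
  ... | old t = t , refl , post-tinj-pinj (inj₁ t) (inj₁ p)
  ... | new j with () ← post-pos (inj₂ j) (inj₁ p) pos

  inputs : ∀ q → (∃ λ p → q ≡ oldP p) ⊎ SoleInput q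
  inputs q with placeView q
  ... | old p = inj₁ (p , refl)
  ... | pa i = inj₂ (newT i , sole)
    where
    sole : ∀ x → 0 < post NΘ x (paP i) → x ≡ newT i
    sole x pos with transView x
    ... | old t with () ← post-pos (inj₁ t) (inj₂ (inj₁ i)) pos
    ... | new j = cong newT (ifDec-pos (j FP.≟ i) (post-pos (inj₂ j) (inj₂ (inj₁ i)) pos))
  ... | pb i = inj₂ (oldT (sT i) , sole)
    where
    sole : ∀ x → 0 < post NΘ x (pbP i) → x ≡ oldT (sT i)
    sole x pos with transView x
    ... | old t = cong oldT (sym (ifDec-pos (sT i FP.≟ t) (post-pos (inj₁ t) (inj₂ (inj₂ i)) pos)))
    ... | new j with () ← post-pos (inj₂ j) (inj₂ (inj₂ i)) pos

  module OutΘ q = Count (λ x → 0 <? pre NΘ q x)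
  module InΘ q = Count (λ x → 0 <? post NΘ x q)
  module Out p = Count (λ t → 0 <? pre N p t)
  module In p = Count (λ t → 0 <? post N t p)

  shared-Θ⇒ : ∀ q → Shared NΘ q → ∃ λ p → q ≡ oldP p × Shared N p
  shared-Θ⇒ q sh with OutΘ.two≤⇒distinct q sh | outputs q
  ... | x , y , x≢y , x>0 , y>0 | inj₂ (z , sole) = ⊥-elim (x≢y (trans (sole x x>0) (sym (sole y y>0))))
  ... | x , y , x≢y , x>0 , y>0 | inj₁ (p , refl , unp) with outputs-unpaired p unp x x>0 | outputs-unpaired p unp y y>0
  ...   | t , refl , pre-t | u , refl , pre-u =
    p , refl , Out.distinct⇒two≤ p t u (λ { refl → x≢y refl }) (subst (0 <_) pre-t x>0) (subst (0 <_) pre-u y>0)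

  shared⇒Θ : ∀ p → Shared N p → Shared NΘ (oldP p)
  shared⇒Θ p sh with Out.two≤⇒distinct p sh
  ... | t , u , t≢u , t>0 , u>0 =
    OutΘ.distinct⇒two≤ (oldP p) (oldT t) (oldT u) (λ e → t≢u (oldT-injective t u e)) (pos t t>0) (pos u u>0)
    where
    unp : Unpaired p
    unp i refl = t≢u (trans (sP-out≡sT i t t>0) (sym (sP-out≡sT i u u>0)))
    pos : ∀ t → 0 < pre N p t → 0 < pre NΘ (oldP p) (oldT t)
    pos t h = subst (0 <_) (sym (trans (pre-pinj-tinj (inj₁ p) (inj₁ t)) (preV-unpaired p t unp))) h

  atMostOneShared : AtMostOneShared N → AtMostOneShared NΘ
  atMostOneShared amos q q' sh sh' with shared-Θ⇒ q sh | shared-Θ⇒ q' sh'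
  ... | p , refl , shp | p' , refl , shp' = cong oldP (amos p p' shp shp')

  homogeneous : Homogeneous N → Homogeneous NΘ
  homogeneous hom q x y x>0 y>0 with outputs q
  ... | inj₂ (z , sole) = cong (pre NΘ q) (trans (sole x x>0) (sym (sole y y>0)))
  ... | inj₁ (p , refl , unp) with outputs-unpaired p unp x x>0 | outputs-unpaired p unp y y>0
  ...   | t , refl , pre-t | u , refl , pre-u =
    trans pre-t (trans (hom p t u (subst (0 <_) pre-t x>0) (subst (0 <_) pre-u y>0)) (sym pre-u))

  record Lifts (keep : P → Set) (keep' : Fin (np NΘ) → Set) : Set where
    field
      old⁺ : ∀ p → keep p → keep' (oldP p)
      old⁻ : ∀ p → keep' (oldP p) → keep p
      pa⁺  : ∀ i → keep' (paP i)
      pb⁺  : ∀ i → keep' (pbP i)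

  lifts-all : Lifts (λ _ → ⊤) (λ _ → ⊤)
  lifts-all = record { old⁺ = λ _ _ → tt ; old⁻ = λ _ _ → tt ; pa⁺ = λ _ → tt ; pb⁺ = λ _ → tt }

  lifts-delete : ∀ p → Lifts (_≢ p) (_≢ oldP p)
  lifts-delete p = record
    { old⁺ = λ p' p'≢p e → p'≢p (old-injective (pinj-injective (inj₁ p') (inj₁ p) e))
    ; old⁻ = λ p' old≢ e → old≢ (cong oldP e)
    ; pa⁺  = λ i e → new≢old (pinj-injective (inj₂ (inj₁ i)) (inj₁ p) e)
    ; pb⁺  = λ i e → new≢old (pinj-injective (inj₂ (inj₂ i)) (inj₁ p) e)
    }
    where
    old-injective : ∀ {p'} → inj₁ p' ≡ inj₁ p → p' ≡ p
    old-injective refl = refl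
    new≢old : ∀ {v} → inj₂ v ≢ inj₁ p
    new≢old ()

  wmg-lift : ∀ {keep keep'} → Lifts keep keep' → WMG≤On N keep → WMG≤On NΘ keep'
  wmg-lift {keep' = keep'} L wmg q kq = InΘ.unique⇒≤1 q (single-input q kq) , OutΘ.unique⇒≤1 q (single-output q kq)
    where
    open Lifts L
    single-input : ∀ q → keep' q → ∀ x y → 0 < post NΘ x q → 0 < post NΘ y q → x ≡ y
    single-input q kq x y x>0 y>0 with inputs q
    ... | inj₂ (z , sole) = trans (sole x x>0) (sym (sole y y>0))
    ... | inj₁ (p , refl) with inputs-old p x x>0 | inputs-old p y y>0
    ...   | t , refl , post-t | u , refl , post-u =
      cong oldT (In.≤1⇒unique p (proj₁ (wmg p (old⁻ p kq))) t u (subst (0 <_) post-t x>0) (subst (0 <_) post-u y>0))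
    single-output : ∀ q → keep' q → ∀ x y → 0 < pre NΘ q x → 0 < pre NΘ q y → x ≡ y
    single-output q kq x y x>0 y>0 with outputs q
    ... | inj₂ (z , sole) = trans (sole x x>0) (sym (sole y y>0))
    ... | inj₁ (p , refl , unp) with outputs-unpaired p unp x x>0 | outputs-unpaired p unp y y>0
    ...   | t , refl , pre-t | u , refl , pre-u =
      cong oldT (Out.≤1⇒unique p (proj₂ (wmg p (old⁻ p kq))) t u (subst (0 <_) pre-t x>0) (subst (0 <_) pre-u y>0))

  arc-pre : ∀ v w → 0 < preV v w → Arc NΘ (inj₁ (pinj v)) (inj₂ (tinj w))
  arc-pre v w = subst (0 <_) (sym (pre-pinj-tinj v w))

  arc-post : ∀ w v → 0 < postV w v → Arc NΘ (inj₂ (tinj w)) (inj₁ (pinj v))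
  arc-post w v = subst (0 <_) (sym (post-tinj-pinj w v))

  embed : Node N → Node NΘ
  embed (inj₁ p) = inj₁ (oldP p)
  embed (inj₂ t) = inj₂ (oldT t)

  module Connectivity {keep keep'} (L : Lifts keep keep') where
    open Lifts L

    R : Node NΘ → Node NΘ → Set
    R = ArcOn NΘ keep'

    oldT→pbP : ∀ i → Star R (inj₂ (oldT (sT i))) (inj₁ (pbP i))
    oldT→pbP i = (tt , pb⁺ i , arc-post (inj₁ (sT i)) (inj₂ (inj₂ i)) (ifDec-yes-pos (sT i FP.≟ sT i) refl (s≤s z≤n))) ◅ ε

    pbP→newT : ∀ i → Star R (inj₁ (pbP i)) (inj₂ (newT i))
    pbP→newT i = (pb⁺ i , tt , arc-pre (inj₂ (inj₂ i)) (inj₂ i) (ifDec-yes-pos (i FP.≟ i) refl (s≤s z≤n))) ◅ ε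

    newT→paP : ∀ i → Star R (inj₂ (newT i)) (inj₁ (paP i))
    newT→paP i = (tt , pa⁺ i , arc-post (inj₂ i) (inj₂ (inj₁ i)) (ifDec-yes-pos (i FP.≟ i) refl (s≤s z≤n))) ◅ ε

    paP→oldT : ∀ i → Star R (inj₁ (paP i)) (inj₂ (oldT (sT i)))
    paP→oldT i = (pa⁺ i , tt , arc-pre (inj₂ (inj₁ i)) (inj₁ (sT i)) (ifDec-yes-pos (sT i FP.≟ sT i) refl (s≤s z≤n))) ◅ ε

    oldP→newT : ∀ i → keep' (oldP (sP i)) → Star R (inj₁ (oldP (sP i))) (inj₂ (newT i))
    oldP→newT i kp = (kp , tt , arc-pre (inj₁ (sP i)) (inj₂ i) (ifDec-yes-pos (sP i FP.≟ sP i) refl (W-pos i))) ◅ ε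

    arc-lift : ∀ a b → ArcOn N keep a b → Star R (embed a) (embed b)
    arc-lift (inj₁ p) (inj₂ t) (kp , _ , p→t) with paired? p
    ... | inj₁ unp = (old⁺ p kp , tt , arc-pre (inj₁ p) (inj₁ t) (subst (0 <_) (sym (preV-unpaired p t unp)) p→t)) ◅ ε
    ... | inj₂ (i , refl) with refl ← sP-out≡sT i t p→t = oldP→newT i (old⁺ (sP i) kp) ◅◅ newT→paP i ◅◅ paP→oldT i
    arc-lift (inj₂ t) (inj₁ p) (_ , kp , t→p) = (tt , old⁺ p kp , arc-post (inj₁ t) (inj₁ p) t→p) ◅ ε

    path-lift : ∀ {a b} → Star (ArcOn N keep) a b → Star R (embed a) (embed b)
    path-lift ε = ε
    path-lift (r ◅ rs) = arc-lift _ _ r ◅◅ path-lift rs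

    OnCycle : Node NΘ → Set
    OnCycle a = ∃ λ s → KeepNode N keep s × Star R (embed s) a × Star R a (embed s)

    onCycle : ∀ a → KeepNode NΘ keep' a → OnCycle a
    onCycle (inj₂ x) _ with transView x
    ... | old t = inj₂ t , tt , ε , ε
    ... | new i = inj₂ (sT i) , tt , oldT→pbP i ◅◅ pbP→newT i , newT→paP i ◅◅ paP→oldT i
    onCycle (inj₁ q) kq with placeView q
    ... | old p = inj₁ p , old⁻ p kq , ε , ε
    ... | pa i = inj₂ (sT i) , tt , oldT→pbP i ◅◅ pbP→newT i ◅◅ newT→paP i , paP→oldT i
    ... | pb i = inj₂ (sT i) , tt , oldT→pbP i , pbP→newT i ◅◅ newT→paP i ◅◅ paP→oldT i

    sc-lift : StronglyConnectedOn N keep → StronglyConnectedOn NΘ keep'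
    sc-lift sc a b ka kb =
      let (s , ks , _ , a→s) = onCycle a ka
          (s' , ks' , s'→b , _) = onCycle b kb
      in a→s ◅◅ path-lift (sc s s' ks ks') ◅◅ s'→b

  sharedDeletion-lift : ∀ {Q : (P → Set) → Set} {Q' : (Fin (np NΘ) → Set) → Set} →
                        (∀ {keep keep'} → Lifts keep keep' → Q keep → Q' keep') →
                        SharedDeletion N Q → SharedDeletion NΘ Q'
  sharedDeletion-lift {Q' = Q'} lift (deleted , noShared) = deleted′ , noShared′
    where
    deleted′ : ∀ q → Shared NΘ q → Q' (λ r → r ≢ q)
    deleted′ q sh with shared-Θ⇒ q sh
    ... | p , refl , shp = lift (lifts-delete p) (deleted p shp)
    noShared′ : (∀ q → ¬ Shared NΘ q) → Q' (λ _ → ⊤)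
    noShared′ ns = lift lifts-all (noShared (λ p sh → ns (oldP p) (shared⇒Θ p sh)))

  structure-preserved : (AtMostOneShared N → AtMostOneShared NΘ)
                        × (Homogeneous N → Homogeneous NΘ)
                        × (H1S-WMG≤ N → H1S-WMG≤ NΘ)
                        × (SC-H1S-WMG≤ N → SC-H1S-WMG≤ NΘ)
  structure-preserved =
      atMostOneShared
    , homogeneous
    , (λ ((hom , amos) , del) → (homogeneous hom , atMostOneShared amos) , sharedDeletion-lift {Q = WMG≤On N} {Q' = WMG≤On NΘ} wmg-lift del)
    , (λ (sc , (hom , amos) , del) →
         Connectivity.sc-lift lifts-all sc
         , (homogeneous hom , atMostOneShared amos)
         , sharedDeletion-lift {Q = λ keep → WMG≤On N keep × StronglyConnectedOn N keep}
                               {Q' = λ keep → WMG≤On NΘ keep × StronglyConnectedOn NΘ keep}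
                               (λ L (wmg , sc′) → wmg-lift L wmg , Connectivity.sc-lift L sc′) del)

module Θ-StructuralBound (S : System) where
  open Θ-Simulation S

  effectΘ : (Trans NΘ → ℕ) → Fin (np NΘ) → ℤ
  effectΘ Y q = sumFin (nt NΘ) (λ x → incidence NΘ q x ℤ.* + Y x)

  effect : (T → ℕ) → P → ℤ
  effect Y p = sumFin (nt N) (λ t → incidence N p t ℤ.* + Y t)

  oldCounts : (Trans NΘ → ℕ) → T → ℕ
  oldCounts Y t = Y (oldT t)

  incidence-split : ∀ Y v → effectΘ Y (pinj v) ≡
     sumFin (nt N) (λ t → (+ postV (inj₁ t) v ℤ.- + preV v (inj₁ t)) ℤ.* + Y (oldT t))
     ℤ.+ sumFin k (λ i → (+ postV (inj₂ i) v ℤ.- + preV v (inj₂ i)) ℤ.* + Y (newT i))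
  incidence-split Y v = trans (sumFin-++ (nt N) k _)
     (cong₂ ℤ._+_ (sumFin-cong (nt N) (λ t → cong (λ z → z ℤ.* + Y (oldT t)) (incidence-tinj (inj₁ t))))
                  (sumFin-cong k (λ i → cong (λ z → z ℤ.* + Y (newT i)) (incidence-tinj (inj₂ i)))))
    where
    incidence-tinj : ∀ w → incidence NΘ (pinj v) (tinj w) ≡ + postV w v ℤ.- + preV v w
    incidence-tinj w = cong₂ (λ a b → + a ℤ.- + b) (post-tinj-pinj w v) (pre-pinj-tinj v w)

  incidence-unpaired : ∀ Y p → Unpaired p → effectΘ Y (oldP p) ≡ effect (oldCounts Y) p
  incidence-unpaired Y p unp = trans (incidence-split Y (inj₁ p))
    (trans (cong₂ ℤ._+_ (sumFin-cong (nt N) (λ t → cong (λ z → (+ post N t p ℤ.- + z) ℤ.* + Y (oldT t)) (preV-unpaired p t unp)))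
                        (sumFin-zero k _ (λ i → cong (λ z → (+ 0 ℤ.- + z) ℤ.* + Y (newT i)) (ifDec-no (sP i FP.≟ p) (unp i)))))
           (ℤP.+-identityʳ _))

  -- The arc (sP i, sT i) now ends in t_i instead of sT i.
  incidence-paired : ∀ Y i → effectΘ Y (oldP (sP i)) ≡
                     effect (oldCounts Y) (sP i) ℤ.+ (+ W i ℤ.* + Y (oldT (sT i)) ℤ.- + W i ℤ.* + Y (newT i))
  incidence-paired Y i = trans (incidence-split Y (inj₁ (sP i)))
    (trans (cong₂ ℤ._+_ oldPart newPart) (regroup (effect (oldCounts Y) (sP i)) (+ W i) (+ Y (oldT (sT i))) (+ Y (newT i))))
    where
    p = sP i
    split : ∀ a b y → a ℤ.* y ≡ (a ℤ.- b) ℤ.* y ℤ.+ b ℤ.* y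
    split = ℤ-solve-∀
    regroup : ∀ s w y yn → (s ℤ.+ w ℤ.* y) ℤ.+ (ℤ.- w) ℤ.* yn ≡ s ℤ.+ (w ℤ.* y ℤ.- w ℤ.* yn)
    regroup = ℤ-solve-∀
    oldPart : sumFin (nt N) (λ t → (+ post N t p ℤ.- + preV (inj₁ p) (inj₁ t)) ℤ.* + Y (oldT t))
              ≡ effect (oldCounts Y) p ℤ.+ + W i ℤ.* + Y (oldT (sT i))
    oldPart = trans (sumFin-cong (nt N) (λ t →
                trans (cong (λ z → (+ post N t p ℤ.- + z) ℤ.* + Y (oldT t)) (preV-paired i t))
                (trans (cong (λ z → z ℤ.* + Y (oldT t)) (ℤP.+-identityʳ (+ post N t p)))
                       (split (+ post N t p) (+ pre N p t) (+ Y (oldT t))))))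
              (trans (sumFin-+ (nt N) _ _)
                (cong (λ z → effect (oldCounts Y) p ℤ.+ z)
                  (sumFin-single (nt N) (λ t → + pre N p t ℤ.* + Y (oldT t)) (sT i)
                     (λ t t≢ → cong (λ z → + z ℤ.* + Y (oldT t)) (pre-sP≡0 i t t≢)))))
    newPart : sumFin k (λ j → (+ 0 ℤ.- + preV (inj₁ p) (inj₂ j)) ℤ.* + Y (newT j)) ≡ (ℤ.- + W i) ℤ.* + Y (newT i)
    newPart = trans (sumFin-single k _ i (λ j j≢i → cong (λ z → (+ 0 ℤ.- + z) ℤ.* + Y (newT j))
                        (ifDec-no (sP j FP.≟ p) (λ e → j≢i (sP-injective j i e)))))
                    (trans (cong (λ z → (+ 0 ℤ.- + z) ℤ.* + Y (newT i)) (ifDec-yes (sP i FP.≟ p) refl))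
                           (cong (λ z → z ℤ.* + Y (newT i)) (ℤP.+-identityˡ (ℤ.- + W i))))

  incidence-pa : ∀ Y i → effectΘ Y (paP i) ≡ + Y (newT i) ℤ.- + Y (oldT (sT i))
  incidence-pa Y i = trans (incidence-split Y (inj₂ (inj₁ i)))
    (trans (cong₂ ℤ._+_
      (trans (sumFin-single (nt N) _ (sT i) (λ t t≢ → cong (λ z → (+ 0 ℤ.- + z) ℤ.* + Y (oldT t)) (ifDec-no (sT i FP.≟ t) (λ e → t≢ (sym e)))))
             (trans (cong (λ z → (+ 0 ℤ.- + z) ℤ.* + Y (oldT (sT i))) (ifDec-yes (sT i FP.≟ sT i) refl)) (ℤP.-1*i≡-i _)))
      (trans (sumFin-single k _ i (λ j j≢i → cong (λ z → (+ z ℤ.- + 0) ℤ.* + Y (newT j)) (ifDec-no (j FP.≟ i) j≢i)))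
             (trans (cong (λ z → (+ z ℤ.- + 0) ℤ.* + Y (newT i)) (ifDec-yes (i FP.≟ i) refl)) (ℤP.*-identityˡ _))))
      (ℤP.+-comm (ℤ.- (+ Y (oldT (sT i)))) (+ Y (newT i))))

  incidence-pb : ∀ Y i → effectΘ Y (pbP i) ≡ + Y (oldT (sT i)) ℤ.- + Y (newT i)
  incidence-pb Y i = trans (incidence-split Y (inj₂ (inj₂ i)))
    (cong₂ ℤ._+_
      (trans (sumFin-single (nt N) _ (sT i) (λ t t≢ → cong (λ z → (+ z ℤ.- + 0) ℤ.* + Y (oldT t)) (ifDec-no (sT i FP.≟ t) (λ e → t≢ (sym e)))))
             (trans (cong (λ z → (+ z ℤ.- + 0) ℤ.* + Y (oldT (sT i))) (ifDec-yes (sT i FP.≟ sT i) refl)) (ℤP.*-identityˡ _)))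
      (trans (sumFin-single k _ i (λ j j≢i → cong (λ z → (+ 0 ℤ.- + z) ℤ.* + Y (newT j)) (ifDec-no (i FP.≟ j) (λ e → j≢i (sym e)))))
             (trans (cong (λ z → (+ 0 ℤ.- + z) ℤ.* + Y (newT i)) (ifDec-yes (i FP.≟ i) refl)) (ℤP.-1*i≡-i _))))

  stateEq-pinj : ∀ {M Y} → StateEq SΘ M Y → ∀ v → + M (pinj v) ≡ + M0V v ℤ.+ effectΘ Y (pinj v)
  stateEq-pinj {Y = Y} se v = trans (se (pinj v)) (cong (λ z → + z ℤ.+ effectΘ Y (pinj v)) (M₀Θ-pinj v))

  stateEq-from-pinj : ∀ {M Y} → (∀ v → + M (pinj v) ≡ + M0V v ℤ.+ effectΘ Y (pinj v)) → StateEq SΘ M Y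
  stateEq-from-pinj {M} {Y} h q = subst (λ r → + M r ≡ + M₀ SΘ r ℤ.+ effectΘ Y r) (pinj-pview q)
    (trans (h (pview q)) (cong (λ z → + z ℤ.+ effectΘ Y (pinj (pview q))) (sym (M₀Θ-pinj (pview q)))))

  stateEq-pa+pb : ∀ {M Y} → StateEq SΘ M Y → ∀ i → M (paP i) + M (pbP i) ≡ 1
  stateEq-pa+pb {M} {Y} se i = ℤP.+-injective (begin
    + M (paP i) ℤ.+ + M (pbP i)
      ≡⟨ cong₂ ℤ._+_ (trans (stateEq-pinj se (inj₂ (inj₁ i))) (cong (λ z → + 0 ℤ.+ z) (incidence-pa Y i)))
                     (trans (stateEq-pinj se (inj₂ (inj₂ i))) (cong (λ z → + 1 ℤ.+ z) (incidence-pb Y i))) ⟩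
    (+ 0 ℤ.+ (yn ℤ.- yo)) ℤ.+ (+ 1 ℤ.+ (yo ℤ.- yn))
      ≡⟨ cancel (+ 0) (+ 1) yn yo ⟩
    + 0 ℤ.+ + 1 ∎)
    where
    open ≡-Reasoning
    yn = + Y (newT i)
    yo = + Y (oldT (sT i))
    cancel : ∀ z o a b → (z ℤ.+ (a ℤ.- b)) ℤ.+ (o ℤ.+ (b ℤ.- a)) ≡ z ℤ.+ o
    cancel = ℤ-solve-∀

  -- m with nothing moved early, and firing counts in which each t_i fires as often as sT i.
  liftMarking : Marking N → Marking NΘ
  liftMarking m x = Sum.[ m , Sum.[ (λ _ → 0) , (λ _ → 1) ]′ ]′ (pview x)

  liftMarking-pinj : ∀ m v → liftMarking m (pinj v) ≡ Sum.[ m , Sum.[ (λ _ → 0) , (λ _ → 1) ]′ ]′ v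
  liftMarking-pinj m v = cong (Sum.[ m , Sum.[ (λ _ → 0) , (λ _ → 1) ]′ ]′) (pview-pinj v)

  liftCount : (T → ℕ) → Trans NΘ → ℕ
  liftCount Y x = Sum.[ Y , (λ i → Y (sT i)) ]′ (tview x)

  liftCount-tinj : ∀ Y w → liftCount Y (tinj w) ≡ Sum.[ Y , (λ i → Y (sT i)) ]′ w
  liftCount-tinj Y w = cong (Sum.[ Y , (λ i → Y (sT i)) ]′) (tview-tinj w)

  corr-lift : ∀ m → Corr m (liftMarking m)
  corr-lift m = record
    { pa+pb≡1  = λ i → cong₂ _+_ (liftMarking-pinj m (inj₂ (inj₁ i))) (liftMarking-pinj m (inj₂ (inj₂ i)))
    ; unpaired = λ p _ → liftMarking-pinj m (inj₁ p)
    ; paired   = λ i → sym (trans (cong₂ (λ a b → a + b * W i) (liftMarking-pinj m (inj₁ (sP i))) (liftMarking-pinj m (inj₂ (inj₁ i))))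
                                  (+-identityʳ _))
    }

  stateEq-lift : ∀ m Y → StateEq S m Y → StateEq SΘ (liftMarking m) (liftCount Y)
  stateEq-lift m Y se = stateEq-from-pinj solves
    where
    old-counts : ∀ p → effect (oldCounts (liftCount Y)) p ≡ effect Y p
    old-counts p = sumFin-cong (nt N) (λ t → cong (λ z → incidence N p t ℤ.* + z) (liftCount-tinj Y (inj₁ t)))
    cancel : ∀ z a → z ≡ z ℤ.+ (a ℤ.- a)
    cancel = ℤ-solve-∀
    cancel′ : ∀ s a → s ℤ.+ (a ℤ.- a) ≡ s
    cancel′ = ℤ-solve-∀
    solves : ∀ v → + liftMarking m (pinj v) ≡ + M0V v ℤ.+ effectΘ (liftCount Y) (pinj v)
    solves (inj₁ p) with paired? p
    ... | inj₁ unp = trans (cong +_ (liftMarking-pinj m (inj₁ p))) (trans (se p) (cong (λ z → + M₀ S p ℤ.+ z)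
                       (sym (trans (incidence-unpaired (liftCount Y) p unp) (old-counts p)))))
    ... | inj₂ (i , refl) = trans (cong +_ (liftMarking-pinj m (inj₁ (sP i)))) (trans (se (sP i)) (cong (λ z → + M₀ S (sP i) ℤ.+ z)
                       (sym (trans (incidence-paired (liftCount Y) i)
                         (trans (cong₂ (λ a b → a ℤ.+ (+ W i ℤ.* + b ℤ.- + W i ℤ.* + liftCount Y (newT i)))
                                       (old-counts (sP i)) (liftCount-tinj Y (inj₁ (sT i))))
                         (trans (cong (λ b → effect Y (sP i) ℤ.+ (+ W i ℤ.* + Y (sT i) ℤ.- + W i ℤ.* + b)) (liftCount-tinj Y (inj₂ i)))
                                (cancel′ (effect Y (sP i)) (+ W i ℤ.* + Y (sT i)))))))))
    solves (inj₂ (inj₁ i)) = trans (cong +_ (liftMarking-pinj m (inj₂ (inj₁ i)))) (trans (cancel (+ 0) (+ Y (sT i)))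
                       (cong (λ z → + 0 ℤ.+ z) (sym (trans (incidence-pa (liftCount Y) i)
                         (cong₂ (λ a b → + a ℤ.- + b) (liftCount-tinj Y (inj₂ i)) (liftCount-tinj Y (inj₁ (sT i))))))))
    solves (inj₂ (inj₂ i)) = trans (cong +_ (liftMarking-pinj m (inj₂ (inj₂ i)))) (trans (cancel (+ 1) (+ Y (sT i)))
                       (cong (λ z → + 1 ℤ.+ z) (sym (trans (incidence-pb (liftCount Y) i)
                         (cong₂ (λ a b → + a ℤ.- + b) (liftCount-tinj Y (inj₁ (sT i))) (liftCount-tinj Y (inj₂ i)))))))

  -- The marking of N represented by M, as in Corr.
  collapse : Marking NΘ → Marking N
  collapse M p = M (oldP p) + Sum.[ (λ _ → 0) , (λ (i , _) → M (paP i) * W i) ]′ (paired? p)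

  collapse-paired : ∀ M i → collapse M (sP i) ≡ M (oldP (sP i)) + M (paP i) * W i
  collapse-paired M i with paired? (sP i)
  ... | inj₁ unp = ⊥-elim (unp i refl)
  ... | inj₂ (j , e) with refl ← sP-injective j i e = refl

  stateEq-collapse : ∀ M Y → StateEq SΘ M Y → StateEq S (collapse M) (oldCounts Y)
  stateEq-collapse M Y se p with paired? p
  ... | inj₁ unp = trans (cong +_ (+-identityʳ _)) (trans (stateEq-pinj se (inj₁ p))
                     (cong (λ z → + M₀ S p ℤ.+ z) (incidence-unpaired Y p unp)))
  ... | inj₂ (i , refl) = begin
    + M (oldP (sP i)) ℤ.+ + (M (paP i) * W i)
      ≡⟨ cong (λ z → + M (oldP (sP i)) ℤ.+ z) (ℤP.pos-* (M (paP i)) (W i)) ⟩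
    + M (oldP (sP i)) ℤ.+ + M (paP i) ℤ.* + W i
      ≡⟨ cong₂ (λ a b → a ℤ.+ b ℤ.* + W i)
           (trans (stateEq-pinj se (inj₁ (sP i))) (cong (λ z → + M₀ S (sP i) ℤ.+ z) (incidence-paired Y i)))
           (trans (stateEq-pinj se (inj₂ (inj₁ i))) (ℤP.+-identityˡ (effectΘ Y (paP i)))) ⟩
    (+ M₀ S (sP i) ℤ.+ (effect (oldCounts Y) (sP i) ℤ.+ (w ℤ.* yo ℤ.- w ℤ.* yn))) ℤ.+ effectΘ Y (paP i) ℤ.* w
      ≡⟨ cong (λ z → (+ M₀ S (sP i) ℤ.+ (effect (oldCounts Y) (sP i) ℤ.+ (w ℤ.* yo ℤ.- w ℤ.* yn))) ℤ.+ z ℤ.* w) (incidence-pa Y i) ⟩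
    (+ M₀ S (sP i) ℤ.+ (effect (oldCounts Y) (sP i) ℤ.+ (w ℤ.* yo ℤ.- w ℤ.* yn))) ℤ.+ (yn ℤ.- yo) ℤ.* w
      ≡⟨ cancel (+ M₀ S (sP i)) (effect (oldCounts Y) (sP i)) w yo yn ⟩
    + M₀ S (sP i) ℤ.+ effect (oldCounts Y) (sP i) ∎
    where
    open ≡-Reasoning
    w = + W i
    yo = + Y (oldT (sT i))
    yn = + Y (newT i)
    cancel : ∀ m s w yo yn → (m ℤ.+ (s ℤ.+ (w ℤ.* yo ℤ.- w ℤ.* yn))) ℤ.+ (yn ℤ.- yo) ℤ.* w ≡ m ℤ.+ s
    cancel = ℤ-solve-∀

  structBound : (∀ p → HasStructBound S p) → ∀ q → HasStructBound SΘ q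
  structBound bounded q with placeView q
  ... | old p =
    let (B , (M* , Y* , se* , reached) , below) = bounded p in
    B , (liftMarking M* , liftCount Y* , stateEq-lift M* Y* se* , trans (liftMarking-pinj M* (inj₁ p)) reached)
      , λ M Y se → ≤-trans (m≤m+n (M (oldP p)) _) (below (collapse M) (oldCounts Y) (stateEq-collapse M Y se))
  ... | pb i =
    1 , (M₀ SΘ , (λ _ → 0) , initial , M₀Θ-pinj (inj₂ (inj₂ i)))
      , λ M Y se → subst (M (pbP i) ≤_) (stateEq-pa+pb se i) (m≤n+m _ _)
    where
    initial : StateEq SΘ (M₀ SΘ) (λ _ → 0)
    initial r = sym (trans (cong (λ z → + M₀ SΘ r ℤ.+ z) (sumFin-zero (nt NΘ) _ (λ x → ℤP.*-zeroʳ (incidence NΘ r x))))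
                           (ℤP.+-identityʳ _))
  ... | pa i with bounded (sP i)
  ...   | B , (M* , Y* , se* , reached) , below with W i ≤? B
  -- p_a^i can be marked iff the bound B of sP i allows t_i to fire at all.
  ...     | yes W≤B =
    let (en , _ , pa≡1 , _) = fireNew (corr-lift M*) i (liftMarking-pinj M* (inj₂ (inj₁ i))) (subst (W i ≤_) (sym reached) W≤B) in
    1 , (fire NΘ (liftMarking M*) (newT i) , _ , stateEq-fire SΘ (liftMarking M*) (liftCount Y*) (newT i) (stateEq-lift M* Y* se*) en , pa≡1)
      , λ M Y se → subst (M (paP i) ≤_) (stateEq-pa+pb se i) (m≤m+n _ _)
  ...     | no W≰B = 0 , (liftMarking M* , liftCount Y* , stateEq-lift M* Y* se* , liftMarking-pinj M* (inj₂ (inj₁ i))) , empty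
    where
    empty : ∀ M Y → StateEq SΘ M Y → M (paP i) ≤ 0
    empty M Y se with M (paP i) in eq
    ... | zero = z≤n
    ... | suc n = ⊥-elim (W≰B (≤-trans W≤ (below (collapse M) (oldCounts Y) (stateEq-collapse M Y se))))
      where
      W≤ : W i ≤ collapse M (sP i)
      W≤ = subst (W i ≤_) (sym (trans (collapse-paired M i) (cong (λ a → M (oldP (sP i)) + a * W i) eq)))
                 (≤-trans (m≤m+n (W i) (n * W i)) (m≤n+m (suc n * W i) (M (oldP (sP i)))))

mainTheorem8 : (S : System) → let open Θ S in
    ((AtMostOneShared (net S) → AtMostOneShared NΘ)
      × (Homogeneous (net S) → Homogeneous NΘ)
      × (H1S-WMG≤ (net S) → H1S-WMG≤ NΘ)
      × (SC-H1S-WMG≤ (net S) → SC-H1S-WMG≤ NΘ))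
    × (∀ α → Feasible S α → Feasible SΘ (θ α))
    × (∀ β' → Feasible SΘ β' →
         Feasible SΘ (θ̂ β')
         × ∃ λ α → Feasible S α × Feasible SΘ (θ α)
                   × (∀ x → parikh (θ α) x ≡ parikh (θ̂ β') x))
    × ((∀ p → HasStructBound S p) → ∀ p → HasStructBound SΘ p)
    × (Deadlockable SΘ ⇔ Deadlockable S)
    × (Live SΘ ⇔ Live S)
mainTheorem8 S =
    Θ-Structure.structure-preserved S
  , θ-feasible
  , θ̂-reduction
  , Θ-StructuralBound.structBound S
  , deadlockable⇔
  , live⇔
  where open Θ-Simulation S
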